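{- For all integers $r\ge1$ and $n\ge0$, as formal power series in $t$, \[ \frac{A_n^r(t,q)}{\prod_{i=0}^n(1-tq^{ri})}=\sum_{k=0}^n\frac{q^{r\binom{k+1}{2}+(1-r)k}\,[r]_q^{\,k}\,[k]_{q^r}!\,S_r[n,k]\,t^k}{\prod_{i=0}^k(1-tq^{ri})}. \]
   Context: $[k]_q=1+q+\dots+q^{k-1}$, $[0]_q=0$, $[k]_q!=\prod_{i=1}^k[i]_q$, and $[k]_{q^r}!$ is this with $q$ replaced by $q^r$. The $r$-colored $q$-Stirling numbers of the second kind are defined by $S_r[0,k]=\delta_{0k}$ and $S_r[n,k]=S_r[n-1,k-1]+[rk+1]_qS_r[n-1,k]$ for $n\ge1$. The colored permutation group $\mathbb{Z}_r\wr\mathfrak{S}_n$ consists of words $\pi=\pi_1^{z_1}\cdots\pi_n^{z_n}$ with $\pi_1\cdots\pi_n$ a permutation of $[n]$ and colors $z_i\in\{0,\dots,r-1\}$ (with $k^0$ written $k$). These letters are totally ordered by $n^{r-1}<\dots<n^1<\dots<1^{r-1}<\dots<1^1<0<1<\dots<n$ (within each letter $k$, larger colors are smaller; all letters with nonzero color are below $0$ and all with color $0$ above $0$). Set $\pi_0^{z_0}=0$. The descent set is $\mathrm{Des}_r(\pi)=\{i\in\{0,\dots,n-1\}:\pi_i^{z_i}>\pi_{i+1}^{z_{i+1}}\}$, $\mathrm{des}_r(\pi)=|\mathrm{Des}_r(\pi)|$, $\mathrm{fmaj}_r(\pi)=r\sum_{i\in\mathrm{Des}_r(\pi)}i+\sum_{i=1}^nz_i$,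 and $A^r_n(t,q)=\sum_{\pi\in\mathbb{Z}_r\wr\mathfrak{S}_n}t^{\mathrm{des}_r(\pi)}q^{\mathrm{fmaj}_r(\pi)}$. -}

module Defs where

open import Data.Nat using (ℕ; zero; suc; _+_; _*_; _∸_; _≤_)
open import Data.Nat.Properties using (_≟_; _<?_)
open import Data.Nat.Combinatorics using (_C_)
open import Data.Bool using (Bool; true; false; if_then_else_; _∧_; _∨_; not)
open import Data.Nat.ListAction using (sum)
open import Data.List using (List; []; _∷_; _++_; map; length; upTo; cartesianProduct; concatMap; filterᵇ)
open import Data.Product using (_×_; _,_; proj₁; proj₂)
open import Relation.Nullary.Decidable using (⌊_⌋)

-- Formal power series in t and q with ℕ coefficients:
-- f a b = coefficient of t^a q^b.  (All series occurring in the
-- statement have nonnegative integer coefficients, and ℤ[q][[t]]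
-- embeds in ℤ[[t,q]], so equality here is equality in ℤ[q][[t]].)

Series : Set
Series = ℕ → ℕ → ℕ

Σ< : ℕ → (ℕ → ℕ) → ℕ
Σ< zero f = 0
Σ< (suc n) f = Σ< n f + f n

zeroS : Series
zeroS a b = 0

mono : ℕ → ℕ → Series
mono i j a b = if ⌊ a ≟ i ⌋ ∧ ⌊ b ≟ j ⌋ then 1 else 0

oneS : Series
oneS = mono 0 0

infixl 6 _⊕_
infixl 7 _⊛_

_⊕_ : Series → Series → Series
(f ⊕ g) a b = f a b + g a b

_⊛_ : Series → Series → Series
(f ⊛ g) a b = Σ< (suc a) (λ i → Σ< (suc b) (λ j → f i j * g (a ∸ i) (b ∸ j)))

sumS : ℕ → (ℕ → Series) → Series
sumS zero F = zeroS
sumS (suc n) F = sumS n F ⊕ F n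

prodS : ℕ → (ℕ → Series) → Series
prodS zero F = oneS
prodS (suc n) F = prodS n F ⊛ F n

powS : ℕ → Series → Series
powS zero f = oneS
powS (suc k) f = powS k f ⊛ f

sumL : List Series → Series
sumL [] = zeroS
sumL (f ∷ fs) = f ⊕ sumL fs

-- 1/(1 - t q^e) = Σ_m t^m q^(e m), the inverse series
geomInv : ℕ → Series
geomInv e a b = if ⌊ b ≟ e * a ⌋ then 1 else 0

invP : ℕ → ℕ → Series
invP r k = prodS (suc k) (λ i → geomInv (r * i))

-- [k]_{q^s} = 1 + q^s + ... + q^(s(k-1))   ([k]_q is s = 1)
qint : ℕ → ℕ → Series
qint s k = sumS k (λ j → mono 0 (s * j))

qfact : ℕ → ℕ → Series
qfact s k = prodS k (λ i → qint s (suc i))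

-- r-colored q-Stirling numbers S_r[n,k] (S_r[n-1,-1] = 0)
Sr : ℕ → ℕ → ℕ → Series
Sr r zero zero = oneS
Sr r zero (suc k) = zeroS
Sr r (suc n) zero = qint 1 1 ⊛ Sr r n zero
Sr r (suc n) (suc k) = Sr r n k ⊕ qint 1 (r * suc k + 1) ⊛ Sr r n (suc k)

-- Colored permutations: a colored letter k^z is the pair (k , z);
-- the letter 0 is (0 , 0).

Letter : Set
Letter = ℕ × ℕ

-- x >ᵇ y  iff  x > y in the order
-- n^{r-1} < ... < n^1 < ... < 1^{r-1} < ... < 1^1 < 0 < 1 < ... < n
_>ᵇ_ : Letter → Letter → Bool
(a , zero) >ᵇ (b , zero) = ⌊ b <? a ⌋
(a , zero) >ᵇ (b , suc w) = true
(a , suc z) >ᵇ (b , zero) = false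
(a , suc z) >ᵇ (b , suc w) = ⌊ a <? b ⌋ ∨ (⌊ a ≟ b ⌋ ∧ ⌊ z <? w ⌋)

words : ℕ → List Letter → List (List Letter)
words zero xs = [] ∷ []
words (suc m) xs = concatMap (λ x → map (x ∷_) (words m xs)) xs

elemᵇ : ℕ → List ℕ → Bool
elemᵇ x [] = false
elemᵇ x (y ∷ ys) = ⌊ x ≟ y ⌋ ∨ elemᵇ x ys

distinctᵇ : List ℕ → Bool
distinctᵇ [] = true
distinctᵇ (x ∷ xs) = not (elemᵇ x xs) ∧ distinctᵇ xs

-- Z_r ≀ S_n : words π_1^{z_1} ... π_n^{z_n}, π a permutation of [n],
-- z_i ∈ {0,...,r-1}
colPerms : ℕ → ℕ → List (List Letter)
colPerms r n =
  filterᵇ (λ w → distinctᵇ (map proj₁ w))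
          (words n (cartesianProduct (map suc (upTo n)) (upTo r)))

-- descent positions i ∈ {0..n-1}, with π_0 = 0
descFrom : ℕ → Letter → List Letter → List ℕ
descFrom i p [] = []
descFrom i p (x ∷ xs) = (if p >ᵇ x then i ∷ [] else []) ++ descFrom (suc i) x xs

Des : List Letter → List ℕ
Des w = descFrom 0 (0 , 0) w

des : List Letter → ℕ
des w = length (Des w)

fmaj : ℕ → List Letter → ℕ
fmaj r w = r * sum (Des w) + sum (map proj₂ w)

A : ℕ → ℕ → Series
A r n = sumL (map (λ w → mono (des w) (fmaj r w)) (colPerms r n))

-- exponent r*binom(k+1,2) + (1-r)k  (a natural number, as r*binom(k+1,2) ≥ r k)
expo : ℕ → ℕ → ℕ
expo r k = (r * (suc k C 2) + k) ∸ r * k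

rhsTerm : ℕ → ℕ → ℕ → Series
rhsTerm r n k =
  mono k (expo r k) ⊛ powS k (qint 1 r) ⊛ qfact r k ⊛ Sr r n k ⊛ invP r k

-- Both sides are compared coefficientwise in t: for every a the coefficient of t^a on either side
-- is [ra+1]_q^n.
--
-- A barred letter is a coloured letter v^c together with a level l; barred letters are
-- ordered level by level, and within a level downwards in the order of coloured letters.  The
-- barred letters weakly below (a, 0) have the weights q^{rl+c} = q^0, …, q^{ra}, so [ra+1]_q^n sums
-- over all ways of choosing one barred letter for each v ∈ [n].  Sorting the choices decreasingly
-- gives a coloured permutation along which the levels decrease weakly, and strictly at descents;
-- this identifies the sum with the t^a-coefficient of A^r_n(t,q) / Π_{i=0}^{n} (1 - t q^{ri}).  The
-- formal proof is an induction on the number of letters that peels off the first letter of the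
-- word on one side and the largest chosen barred letter on the other.
--
-- The t^a-coefficient Z_k(a) of the k-th summand divided by S_r[n,k] involves
-- h_{a-k}(1, q^r, …, q^{rk}), and [k]_{q^r}! h_m(1, q^r, …, q^{rk}) = [m+1]_{q^r} ⋯ [m+k]_{q^r}.
-- With this, [ra+1]_q Z_k(a) = [rk+1]_q Z_k(a) + Z_{k+1}(a), which matches the recurrence of
-- S_r[n,k], so that Σ_k S_r[n,k] Z_k(a) = [ra+1]_q^n by induction on n.

module Submission where

open import Defs
open import Algebra.Bundles using (CommutativeSemiring)
open import Algebra.Structures using (IsCommutativeMonoid)
open import Algebra.Structures.Biased using (IsCommutativeSemiringˡ)
open import Data.Bool using (Bool; true; false; if_then_else_; _∧_; _∨_; not)
open import Data.Empty using (⊥; ⊥-elim)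
open import Data.List using (List; []; _∷_; _++_; map; length; upTo; applyUpTo; cartesianProduct; concatMap; filterᵇ)
import Data.List.Properties as List
open import Data.List.Membership.Propositional using (_∈_)
open import Data.List.Relation.Unary.All as All using (All; []; _∷_)
import Data.List.Relation.Unary.All.Properties as Allₚ
open import Data.List.Relation.Unary.Any using (here; there)
open import Data.List.Relation.Unary.Unique.Propositional using (Unique; []; _∷_)
import Data.List.Relation.Unary.Unique.Propositional.Properties as Uniqueₚ
open import Data.Nat using (ℕ; zero; suc; _∸_; _<_; _≤_; z≤n; s≤s; _≟_; _≤?_; _<?_)
  renaming (_+_ to _+ℕ_; _*_ to _*ℕ_)
import Data.Nat.Properties as ℕ
open import Data.Nat.Combinatorics using (_C_; nC1≡n; nCk+nC[k+1]≡[n+1]C[k+1])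
open import Data.Nat.ListAction using (sum)
open import Data.Nat.Tactic.RingSolver using (solve-∀)
open import Data.Product using (_×_; _,_; proj₁; proj₂)
open import Data.Sum using (_⊎_; inj₁; inj₂)
open import Function using (_∘_)
open import Relation.Binary.Definitions using (tri<; tri≈; tri>)
open import Relation.Binary.PropositionalEquality as ≡ using (_≡_; _≢_)
open import Relation.Nullary using (Dec; yes; no)
open import Relation.Nullary.Decidable using (⌊_⌋; T?)

module FiniteSum {c ℓ} (R : CommutativeSemiring c ℓ) where
  open CommutativeSemiring R
  open import Algebra.Properties.CommutativeSemigroup +-commutativeSemigroup using (interchange)
  open import Relation.Binary.Reasoning.Setoid setoid

  Σ : ℕ → (ℕ → Carrier) → Carrier
  Σ zero f = 0#
  Σ (suc n) f = Σ n f + f n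

  ΣL : {X : Set} → (X → Carrier) → List X → Carrier
  ΣL f [] = 0#
  ΣL f (x ∷ xs) = f x + ΣL f xs

  ΠL : {X : Set} → (X → Carrier) → List X → Carrier
  ΠL f [] = 1#
  ΠL f (x ∷ xs) = f x * ΠL f xs

  Π : ℕ → (ℕ → Carrier) → Carrier
  Π zero f = 1#
  Π (suc n) f = Π n f * f n

  when : Bool → Carrier → Carrier
  when b x = if b then x else 0#

  Σ-cong-< : ∀ n {f g} → (∀ i → i < n → f i ≈ g i) → Σ n f ≈ Σ n g
  Σ-cong-< zero h = refl
  Σ-cong-< (suc n) h = +-cong (Σ-cong-< n (λ i i<n → h i (ℕ.m<n⇒m<1+n i<n))) (h n ℕ.≤-refl)

  Σ-cong : ∀ n {f g} → (∀ i → f i ≈ g i) → Σ n f ≈ Σ n g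
  Σ-cong n h = Σ-cong-< n (λ i _ → h i)

  Σ-≡ : ∀ {m n} f → m ≡ n → Σ m f ≈ Σ n f
  Σ-≡ f ≡.refl = refl

  Σ-distrib-+ : ∀ n f g → Σ n (λ i → f i + g i) ≈ Σ n f + Σ n g
  Σ-distrib-+ zero f g = sym (+-identityˡ 0#)
  Σ-distrib-+ (suc n) f g = trans (+-congʳ (Σ-distrib-+ n f g)) (interchange _ _ _ _)

  *-distribˡ-Σ : ∀ n x f → x * Σ n f ≈ Σ n (λ i → x * f i)
  *-distribˡ-Σ zero x f = zeroʳ x
  *-distribˡ-Σ (suc n) x f = trans (distribˡ x (Σ n f) (f n)) (+-congʳ (*-distribˡ-Σ n x f))

  *-distribʳ-Σ : ∀ n f x → Σ n f * x ≈ Σ n (λ i → f i * x)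
  *-distribʳ-Σ n f x = trans (*-comm _ x) (trans (*-distribˡ-Σ n x f) (Σ-cong n (λ i → *-comm x (f i))))

  Σ-zero : ∀ n f → (∀ i → i < n → f i ≈ 0#) → Σ n f ≈ 0#
  Σ-zero zero f h = refl
  Σ-zero (suc n) f h = trans (+-cong (Σ-zero n f (λ i i<n → h i (ℕ.m<n⇒m<1+n i<n))) (h n ℕ.≤-refl)) (+-identityʳ 0#)

  Σ-comm : ∀ n m (f : ℕ → ℕ → Carrier) → Σ n (λ i → Σ m (f i)) ≈ Σ m (λ j → Σ n (λ i → f i j))
  Σ-comm zero m f = sym (Σ-zero m _ (λ _ _ → refl))
  Σ-comm (suc n) m f = trans (+-congʳ (Σ-comm n m f)) (sym (Σ-distrib-+ m _ _))

  Σ-unfoldˡ : ∀ n f → Σ (suc n) f ≈ f 0 + Σ n (λ i → f (suc i))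
  Σ-unfoldˡ zero f = trans (+-identityˡ _) (sym (+-identityʳ _))
  Σ-unfoldˡ (suc n) f = trans (+-congʳ (Σ-unfoldˡ n f)) (+-assoc _ _ _)

  Π-cong : ∀ n {f g} → (∀ i → f i ≈ g i) → Π n f ≈ Π n g
  Π-cong zero h = refl
  Π-cong (suc n) h = *-cong (Π-cong n h) (h n)

  Π-unfoldˡ : ∀ n f → Π (suc n) f ≈ f 0 * Π n (λ i → f (suc i))
  Π-unfoldˡ zero f = trans (*-identityˡ _) (sym (*-identityʳ _))
  Π-unfoldˡ (suc n) f = trans (*-congʳ (Π-unfoldˡ n f)) (*-assoc _ _ _)

  Σ-reverse : ∀ n f → Σ n f ≈ Σ n (λ i → f (n ∸ suc i))
  Σ-reverse zero f = refl
  Σ-reverse (suc n) f = begin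
    Σ n f + f n                           ≈⟨ +-congʳ (Σ-reverse n f) ⟩
    Σ n (λ i → f (n ∸ suc i)) + f n       ≈⟨ +-comm _ _ ⟩
    f n + Σ n (λ i → f (n ∸ suc i))       ≈⟨ Σ-unfoldˡ n (λ i → f (suc n ∸ suc i)) ⟨
    Σ (suc n) (λ i → f (suc n ∸ suc i))   ∎

  Σ-single : ∀ n f j → j < n → (∀ i → i < n → i ≢ j → f i ≈ 0#) → Σ n f ≈ f j
  Σ-single (suc n) f j j<1+n h with j ≟ n
  ... | yes ≡.refl = trans (+-congʳ (Σ-zero n f (λ i i<n → h i (ℕ.m<n⇒m<1+n i<n) (ℕ.<⇒≢ i<n)))) (+-identityˡ _)
  ... | no j≢n = trans (+-cong (Σ-single n f j (ℕ.≤∧≢⇒< (ℕ.≤-pred j<1+n) j≢n) (λ i i<n → h i (ℕ.m<n⇒m<1+n i<n)))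
                               (h n ℕ.≤-refl (j≢n ∘′ ≡.sym)))
                       (+-identityʳ _)
    where open import Function using (_∘′_)

  Σ-split : ∀ m k f → Σ (m +ℕ k) f ≈ Σ m f + Σ k (λ i → f (m +ℕ i))
  Σ-split m zero f = trans (Σ-≡ f (ℕ.+-identityʳ m)) (sym (+-identityʳ _))
  Σ-split m (suc k) f = trans (Σ-≡ f (ℕ.+-suc m k)) (trans (+-congʳ (Σ-split m k f)) (+-assoc _ _ _))

  Σ-blocks : ∀ r a f → Σ (r *ℕ a) f ≈ Σ a (λ l → Σ r (λ c → f (r *ℕ l +ℕ c)))
  Σ-blocks r zero f = Σ-≡ f (ℕ.*-zeroʳ r)
  Σ-blocks r (suc a) f = trans (Σ-≡ f (≡.trans (ℕ.*-suc r a) (ℕ.+-comm r (r *ℕ a))))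
                               (trans (Σ-split (r *ℕ a) r f) (+-congʳ (Σ-blocks r a f)))

  Σ-triangle : ∀ n (F : ℕ → ℕ → Carrier) →
    Σ (suc n) (λ k → Σ (suc k) (λ i → F i k)) ≈ Σ (suc n) (λ i → Σ (suc (n ∸ i)) (λ k → F i (i +ℕ k)))
  Σ-triangle zero F = refl
  Σ-triangle (suc n) F = begin
    Σ (suc n) (λ k → Σ (suc k) (λ i → F i k)) + (Σ (suc n) (λ i → F i (suc n)) + F (suc n) (suc n))
      ≈⟨ +-congʳ (Σ-triangle n F) ⟩
    Σ (suc n) (λ i → Σ (suc (n ∸ i)) (λ k → F i (i +ℕ k))) + (Σ (suc n) (λ i → F i (suc n)) + F (suc n) (suc n))
      ≈⟨ +-assoc _ _ _ ⟨
    Σ (suc n) (λ i → Σ (suc (n ∸ i)) (λ k → F i (i +ℕ k))) + Σ (suc n) (λ i → F i (suc n)) + F (suc n) (suc n)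
      ≈⟨ +-cong (trans (sym (Σ-distrib-+ (suc n) _ _)) (Σ-cong-< (suc n) column)) last ⟩
    Σ (suc n) (λ i → Σ (suc (suc n ∸ i)) (λ k → F i (i +ℕ k))) + Σ (suc (n ∸ n)) (λ k → F (suc n) (suc n +ℕ k))
      ∎
    where
    column : ∀ i → i < suc n →
      Σ (suc (n ∸ i)) (λ k → F i (i +ℕ k)) + F i (suc n) ≈ Σ (suc (suc n ∸ i)) (λ k → F i (i +ℕ k))
    column i (s≤s i≤n) rewrite ℕ.+-∸-assoc 1 i≤n =
      +-congˡ (reflexive (≡.cong (F i) (≡.trans (≡.sym (ℕ.m+[n∸m]≡n (ℕ.m≤n⇒m≤1+n i≤n)))
                                                (≡.cong (i +ℕ_) (ℕ.+-∸-assoc 1 i≤n)))))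
    last : F (suc n) (suc n) ≈ Σ (suc (n ∸ n)) (λ k → F (suc n) (suc n +ℕ k))
    last rewrite ℕ.n∸n≡0 n | ℕ.+-identityʳ (suc n) = sym (+-identityˡ _)

  Σ-truncate : ∀ m n (f : ℕ → Carrier) → m ≤ n → Σ n (λ l → when ⌊ l <? m ⌋ (f l)) ≈ Σ m f
  Σ-truncate m n f m≤n with ℕ.m≤n⇒∃[o]m+o≡n m≤n
  ... | k , ≡.refl = truncate k
    where
    truncate : ∀ k → Σ (m +ℕ k) (λ l → when ⌊ l <? m ⌋ (f l)) ≈ Σ m f
    truncate zero = trans (Σ-≡ _ (ℕ.+-identityʳ m)) (Σ-cong-< m (λ l l<m → reflexive (≡.cong (λ b → when b (f l)) (isYes-< l<m))))
      where
      isYes-< : ∀ {l} → l < m → ⌊ l <? m ⌋ ≡ true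
      isYes-< {l} l<m with l <? m
      ... | yes _ = ≡.refl
      ... | no l≮m = ⊥-elim (l≮m l<m)
    truncate (suc k) = trans (Σ-≡ _ (ℕ.+-suc m k)) (trans (+-cong (truncate k) (reflexive (≡.cong (λ b → when b (f (m +ℕ k))) isNo)))
                                                           (+-identityʳ _))
      where
      isNo : ⌊ m +ℕ k <? m ⌋ ≡ false
      isNo with m +ℕ k <? m
      ... | yes m+k<m = ⊥-elim (ℕ.<⇒≱ m+k<m (ℕ.m≤m+n m k))
      ... | no _ = ≡.refl

  module _ {X : Set} where

    ΣL-cong : ∀ {f g : X → Carrier} xs → (∀ x → x ∈ xs → f x ≈ g x) → ΣL f xs ≈ ΣL g xs
    ΣL-cong [] h = refl
    ΣL-cong (x ∷ xs) h = +-cong (h x (here ≡.refl)) (ΣL-cong xs (λ y y∈xs → h y (there y∈xs)))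

    ΠL-cong : ∀ {f g : X → Carrier} xs → (∀ x → x ∈ xs → f x ≈ g x) → ΠL f xs ≈ ΠL g xs
    ΠL-cong [] h = refl
    ΠL-cong (x ∷ xs) h = *-cong (h x (here ≡.refl)) (ΠL-cong xs (λ y y∈xs → h y (there y∈xs)))

    ΣL-distrib-+ : ∀ (f g : X → Carrier) xs → ΣL (λ x → f x + g x) xs ≈ ΣL f xs + ΣL g xs
    ΣL-distrib-+ f g [] = sym (+-identityˡ 0#)
    ΣL-distrib-+ f g (x ∷ xs) = trans (+-congˡ (ΣL-distrib-+ f g xs)) (interchange _ _ _ _)

    *-distribˡ-ΣL : ∀ y (f : X → Carrier) xs → y * ΣL f xs ≈ ΣL (λ x → y * f x) xs
    *-distribˡ-ΣL y f [] = zeroʳ y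
    *-distribˡ-ΣL y f (x ∷ xs) = trans (distribˡ _ _ _) (+-congˡ (*-distribˡ-ΣL y f xs))

    *-distribʳ-ΣL : ∀ (f : X → Carrier) xs y → ΣL f xs * y ≈ ΣL (λ x → f x * y) xs
    *-distribʳ-ΣL f xs y = trans (*-comm _ y) (trans (*-distribˡ-ΣL y f xs) (ΣL-cong xs (λ x _ → *-comm y (f x))))

    ΣL-zero : ∀ (f : X → Carrier) xs → (∀ x → x ∈ xs → f x ≈ 0#) → ΣL f xs ≈ 0#
    ΣL-zero f xs h = trans (ΣL-cong xs h) (zeros xs)
      where
      zeros : ∀ xs → ΣL (λ _ → 0#) xs ≈ 0#
      zeros [] = refl
      zeros (x ∷ xs) = trans (+-identityˡ _) (zeros xs)

    ΣL-++ : ∀ (f : X → Carrier) xs ys → ΣL f (xs ++ ys) ≈ ΣL f xs + ΣL f ys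
    ΣL-++ f [] ys = sym (+-identityˡ _)
    ΣL-++ f (x ∷ xs) ys = trans (+-congˡ (ΣL-++ f xs ys)) (sym (+-assoc _ _ _))

  ΣL-map : ∀ {X Y : Set} (f : Y → Carrier) (h : X → Y) xs → ΣL f (map h xs) ≈ ΣL (λ x → f (h x)) xs
  ΣL-map f h [] = refl
  ΣL-map f h (x ∷ xs) = +-congˡ (ΣL-map f h xs)

  ΣL-concatMap : ∀ {X Y : Set} (f : Y → Carrier) (g : X → List Y) xs →
    ΣL f (concatMap g xs) ≈ ΣL (λ x → ΣL f (g x)) xs
  ΣL-concatMap f g [] = refl
  ΣL-concatMap f g (x ∷ xs) = trans (ΣL-++ f (g x) (concatMap g xs)) (+-congˡ (ΣL-concatMap f g xs))

module PowerSeries {c ℓ} (R : CommutativeSemiring c ℓ) where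
  open CommutativeSemiring R
  open FiniteSum R public
  open import Relation.Binary.Reasoning.Setoid setoid

  PS : Set c
  PS = ℕ → Carrier

  infix 4 _≋_
  infixl 6 _⊞_
  infixl 7 _⊠_

  _≋_ : PS → PS → Set ℓ
  f ≋ g = ∀ n → f n ≈ g n

  _⊞_ : PS → PS → PS
  (f ⊞ g) n = f n + g n

  _⊠_ : PS → PS → PS
  (f ⊠ g) n = Σ (suc n) (λ i → f i * g (n ∸ i))

  monomial : ℕ → Carrier → PS
  monomial i x n = if ⌊ n ≟ i ⌋ then x else 0#

  𝟘 : PS
  𝟘 _ = 0#

  𝟙 : PS
  𝟙 = monomial 0 1#

  ⊞-cong : ∀ {f f′ g g′} → f ≋ f′ → g ≋ g′ → f ⊞ g ≋ f′ ⊞ g′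
  ⊞-cong p q n = +-cong (p n) (q n)

  ⊠-cong : ∀ {f f′ g g′} → f ≋ f′ → g ≋ g′ → f ⊠ g ≋ f′ ⊠ g′
  ⊠-cong p q n = Σ-cong (suc n) (λ i → *-cong (p i) (q (n ∸ i)))

  ⊞-congˡ : ∀ f {g g′} → g ≋ g′ → f ⊞ g ≋ f ⊞ g′
  ⊞-congˡ f = ⊞-cong {f} {f} (λ _ → refl)

  ⊞-congʳ : ∀ g {f f′} → f ≋ f′ → f ⊞ g ≋ f′ ⊞ g
  ⊞-congʳ g f≋f′ = ⊞-cong {g = g} {g′ = g} f≋f′ (λ _ → refl)

  ⊠-congˡ : ∀ f {g g′} → g ≋ g′ → f ⊠ g ≋ f ⊠ g′
  ⊠-congˡ f = ⊠-cong {f} {f} (λ _ → refl)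

  ⊠-congʳ : ∀ g {f f′} → f ≋ f′ → f ⊠ g ≋ f′ ⊠ g
  ⊠-congʳ g f≋f′ = ⊠-cong {g = g} {g′ = g} f≋f′ (λ _ → refl)

  ⊠-comm : ∀ f g → f ⊠ g ≋ g ⊠ f
  ⊠-comm f g n = trans (Σ-reverse (suc n) _) (Σ-cong-< (suc n) (λ i i<1+n →
    trans (*-comm _ _) (*-congʳ (reflexive (≡.cong g (ℕ.m∸[m∸n]≡n (ℕ.≤-pred i<1+n)))))))

  ⊠-assoc : ∀ f g h → (f ⊠ g) ⊠ h ≋ f ⊠ (g ⊠ h)
  ⊠-assoc f g h n = begin
    Σ (suc n) (λ k → Σ (suc k) (λ i → f i * g (k ∸ i)) * h (n ∸ k))
      ≈⟨ Σ-cong (suc n) (λ k → *-distribʳ-Σ (suc k) _ _) ⟩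
    Σ (suc n) (λ k → Σ (suc k) (λ i → (f i * g (k ∸ i)) * h (n ∸ k)))
      ≈⟨ Σ-triangle n (λ i k → (f i * g (k ∸ i)) * h (n ∸ k)) ⟩
    Σ (suc n) (λ i → Σ (suc (n ∸ i)) (λ k → (f i * g ((i +ℕ k) ∸ i)) * h (n ∸ (i +ℕ k))))
      ≈⟨ Σ-cong (suc n) (λ i → Σ-cong (suc (n ∸ i)) (λ k → trans
           (*-cong (*-congˡ (reflexive (≡.cong g (ℕ.m+n∸m≡n i k))))
                   (reflexive (≡.cong h (≡.sym (ℕ.∸-+-assoc n i k)))))
           (*-assoc _ _ _))) ⟩
    Σ (suc n) (λ i → Σ (suc (n ∸ i)) (λ k → f i * (g k * h ((n ∸ i) ∸ k))))
      ≈⟨ Σ-cong (suc n) (λ i → *-distribˡ-Σ (suc (n ∸ i)) _ _) ⟨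
    Σ (suc n) (λ i → f i * Σ (suc (n ∸ i)) (λ k → g k * h ((n ∸ i) ∸ k)))
      ∎

  ⊠-identityˡ : ∀ f → 𝟙 ⊠ f ≋ f
  ⊠-identityˡ f n = begin
    Σ (suc n) (λ i → 𝟙 i * f (n ∸ i))        ≈⟨ Σ-unfoldˡ n _ ⟩
    1# * f n + Σ n (λ i → 0# * f (n ∸ suc i)) ≈⟨ +-cong (*-identityˡ _) (Σ-zero n _ (λ i _ → zeroˡ _)) ⟩
    f n + 0#                                  ≈⟨ +-identityʳ _ ⟩
    f n                                       ∎

  ⊠-zeroˡ : ∀ f → 𝟘 ⊠ f ≋ 𝟘
  ⊠-zeroˡ f n = Σ-zero (suc n) _ (λ i _ → zeroˡ _)

  ⊠-distribʳ : ∀ f g h → (g ⊞ h) ⊠ f ≋ g ⊠ f ⊞ h ⊠ f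
  ⊠-distribʳ f g h n = trans (Σ-cong (suc n) (λ i → distribʳ _ _ _)) (Σ-distrib-+ (suc n) _ _)

  PS-commutativeSemiring : CommutativeSemiring c ℓ
  PS-commutativeSemiring = record
    { Carrier = PS ; _≈_ = _≋_ ; _+_ = _⊞_ ; _*_ = _⊠_ ; 0# = 𝟘 ; 1# = 𝟙
    ; isCommutativeSemiring = IsCommutativeSemiringˡ.isCommutativeSemiring (record
        { +-isCommutativeMonoid = commutativeMonoid _⊞_ 𝟘 ⊞-cong
            (λ f g h n → +-assoc (f n) (g n) (h n)) (λ f n → +-identityˡ (f n)) (λ f g n → +-comm (f n) (g n))
        ; *-isCommutativeMonoid = commutativeMonoid _⊠_ 𝟙 ⊠-cong ⊠-assoc ⊠-identityˡ ⊠-comm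
        ; distribʳ = ⊠-distribʳ
        ; zeroˡ = ⊠-zeroˡ }) }
    where
    commutativeMonoid : ∀ _∙_ ε → (∀ {f f′ g g′} → f ≋ f′ → g ≋ g′ → (f ∙ g) ≋ (f′ ∙ g′)) →
      (∀ f g h → ((f ∙ g) ∙ h) ≋ (f ∙ (g ∙ h))) → (∀ f → (ε ∙ f) ≋ f) → (∀ f g → (f ∙ g) ≋ (g ∙ f)) →
      IsCommutativeMonoid _≋_ _∙_ ε
    commutativeMonoid _∙_ ε cong assoc identityˡ comm = record
      { isMonoid = record
        { isSemigroup = record
          { isMagma = record
            { isEquivalence = record { refl = λ n → refl ; sym = λ p n → sym (p n) ; trans = λ p q n → trans (p n) (q n) }
            ; ∙-cong = cong }
          ; assoc = assoc }
        ; identity = identityˡ , (λ f → λ n → trans (comm f ε n) (identityˡ f n)) }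
      ; comm = comm }

  monomial-self : ∀ i x → monomial i x i ≡ x
  monomial-self i x with i ≟ i
  ... | yes _ = ≡.refl
  ... | no i≢i = ⊥-elim (i≢i ≡.refl)

  monomial-≢ : ∀ i x n → n ≢ i → monomial i x n ≡ 0#
  monomial-≢ i x n n≢i with n ≟ i
  ... | yes n≡i = ⊥-elim (n≢i n≡i)
  ... | no _ = ≡.refl

  monomial-cong : ∀ i {x y} → x ≈ y → monomial i x ≋ monomial i y
  monomial-cong i x≈y n with n ≟ i
  ... | yes _ = x≈y
  ... | no _ = refl

  monomial-+ˡ : ∀ i j x o → monomial (i +ℕ j) x (i +ℕ o) ≡ monomial j x o
  monomial-+ˡ i j x o with o ≟ j | (i +ℕ o) ≟ (i +ℕ j)
  ... | yes _ | yes _ = ≡.refl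
  ... | no _ | no _ = ≡.refl
  ... | yes o≡j | no i+o≢i+j = ⊥-elim (i+o≢i+j (≡.cong (i +ℕ_) o≡j))
  ... | no o≢j | yes i+o≡i+j = ⊥-elim (o≢j (ℕ.+-cancelˡ-≡ i _ _ i+o≡i+j))

  *-monomial : ∀ x i y n → x * monomial i y n ≈ monomial i (x * y) n
  *-monomial x i y n with n ≟ i
  ... | yes _ = refl
  ... | no _ = zeroʳ x

  monomial-⊠-+ : ∀ i x f a → (monomial i x ⊠ f) (i +ℕ a) ≈ x * f a
  monomial-⊠-+ i x f a = begin
    Σ (suc (i +ℕ a)) (λ k → monomial i x k * f (i +ℕ a ∸ k))
      ≈⟨ Σ-single (suc (i +ℕ a)) _ i (s≤s (ℕ.m≤m+n i a))
           (λ k _ k≢i → trans (*-congʳ (reflexive (monomial-≢ i x k k≢i))) (zeroˡ _)) ⟩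
    monomial i x i * f (i +ℕ a ∸ i)
      ≡⟨ ≡.cong₂ _*_ (monomial-self i x) (≡.cong f (ℕ.m+n∸m≡n i a)) ⟩
    x * f a ∎

  monomial-⊠-< : ∀ i x f a → a < i → (monomial i x ⊠ f) a ≈ 0#
  monomial-⊠-< i x f a a<i = Σ-zero (suc a) _ (λ k k≤a →
    trans (*-congʳ (reflexive (monomial-≢ i x k (λ k≡i → ℕ.<-irrefl k≡i (ℕ.≤-<-trans (ℕ.≤-pred k≤a) a<i)))))
          (zeroˡ _))

  monomial-⊠-monomial : ∀ i x j y → monomial i x ⊠ monomial j y ≋ monomial (i +ℕ j) (x * y)
  monomial-⊠-monomial i x j y n with i ≤? n
  ... | no i≰n = trans (monomial-⊠-< i x (monomial j y) n (ℕ.≰⇒> i≰n))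
    (reflexive (≡.sym (monomial-≢ (i +ℕ j) _ n (λ n≡i+j → i≰n (≡.subst (i ≤_) (≡.sym n≡i+j) (ℕ.m≤m+n i j))))))
  ... | yes i≤n with ℕ.m≤n⇒∃[o]m+o≡n i≤n
  ...   | o , ≡.refl = trans (monomial-⊠-+ i x (monomial j y) o)
                         (trans (*-monomial x j y o) (reflexive (≡.sym (monomial-+ˡ i j (x * y) o))))

  monomial-zero : ∀ i {x} → x ≈ 0# → monomial i x ≋ 𝟘
  monomial-zero i x≈0 n with n ≟ i
  ... | yes _ = x≈0
  ... | no _ = refl

  monomial-⊞ : ∀ i x y → monomial i x ⊞ monomial i y ≋ monomial i (x + y)
  monomial-⊞ i x y n with n ≟ i
  ... | yes _ = refl
  ... | no _ = +-identityʳ 0#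

  monomial-⊠-constant : ∀ i x y → monomial i x ⊠ monomial 0 y ≋ monomial i (x * y)
  monomial-⊠-constant i x y n =
    trans (⊠-comm (monomial i x) (monomial 0 y) n)
          (trans (monomial-⊠-monomial 0 y i x n) (monomial-cong i (*-comm y x) n))

-- Products of sums, expanded by the largest chosen term

remove : ℕ → List ℕ → List ℕ
remove v = filterᵇ (λ u → not ⌊ v ≟ u ⌋)

remove-fresh : ∀ v us → All (v ≢_) us → remove v us ≡ us
remove-fresh v [] [] = ≡.refl
remove-fresh v (u ∷ us) (v≢u ∷ v∉us) with v ≟ u
... | yes v≡u = ⊥-elim (v≢u v≡u)
... | no _ = ≡.cong (u ∷_) (remove-fresh v us v∉us)

remove-head : ∀ v us → remove v (v ∷ us) ≡ remove v us
remove-head v us with v ≟ v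
... | yes _ = ≡.refl
... | no v≢v = ⊥-elim (v≢v ≡.refl)

remove-other : ∀ u v us → u ≢ v → remove u (v ∷ us) ≡ v ∷ remove u us
remove-other u v us u≢v with u ≟ v
... | yes u≡v = ⊥-elim (u≢v u≡v)
... | no _ = ≡.refl

∈-remove⁻ : ∀ {u} v vs → u ∈ remove v vs → u ∈ vs × u ≢ v
∈-remove⁻ v (w ∷ vs) u∈ with v ≟ w
... | yes ≡.refl = let u∈vs , u≢v = ∈-remove⁻ v vs u∈ in there u∈vs , u≢v
∈-remove⁻ v (w ∷ vs) (here ≡.refl) | no v≢w = here ≡.refl , v≢w ∘ ≡.sym
∈-remove⁻ v (w ∷ vs) (there u∈) | no _ = let u∈vs , u≢v = ∈-remove⁻ v vs u∈ in there u∈vs , u≢v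

length-remove : ∀ v vs m → length vs ≡ suc m → Unique vs → v ∈ vs → length (remove v vs) ≡ m
length-remove v (w ∷ vs) m len (w∉vs ∷ _) (here ≡.refl) =
  ≡.trans (≡.cong length (≡.trans (remove-head v vs) (remove-fresh v vs w∉vs))) (ℕ.suc-injective len)
length-remove v (w ∷ []) zero _ _ (there ())
length-remove v (w ∷ vs) (suc m) len (w∉vs ∷ vs!) (there v∈vs) =
  ≡.trans (≡.cong length (remove-other v w vs (λ { ≡.refl → Allₚ.All¬⇒¬Any w∉vs v∈vs })))
          (≡.cong suc (length-remove v vs m (ℕ.suc-injective len) vs! v∈vs))

remove-Unique : ∀ v vs → Unique vs → Unique (remove v vs)
remove-Unique v vs = Uniqueₚ.filter⁺ _

remove-All : ∀ {P : ℕ → Set} v vs → All P vs → All P (remove v vs)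
remove-All v vs = Allₚ.filter⁺ _

module MaximumDecomposition {c ℓ} (R : CommutativeSemiring c ℓ) where
  open CommutativeSemiring R hiding (zero)
  open FiniteSum R
  open import Relation.Binary.Reasoning.Setoid setoid
  open import Algebra.Solver.Ring.NaturalCoefficients.Default R

  ΠL-binomial : ∀ (S D : ℕ → Carrier) us → Unique us → (∀ {u v} → u ∈ us → v ∈ us → u ≢ v → D u * D v ≈ 0#) →
    ΠL (λ v → S v + D v) us ≈ ΠL S us + ΣL (λ v → D v * ΠL S (remove v us)) us
  ΠL-binomial S D [] _ _ = sym (+-identityʳ _)
  ΠL-binomial S D (v ∷ us) (v∉us ∷ us!) DD≈0 = begin
    (S v + D v) * ΠL (λ v → S v + D v) us
      ≈⟨ *-congˡ (ΠL-binomial S D us us! (λ u∈ v∈ → DD≈0 (there u∈) (there v∈))) ⟩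
    (S v + D v) * (P + Z)
      ≈⟨ solve 4 (λ s d p z → (s :+ d) :* (p :+ z) := (s :* p :+ (d :* p :+ s :* z)) :+ d :* z) refl (S v) (D v) P Z ⟩
    (S v * P + (D v * P + S v * Z)) + D v * Z
      ≈⟨ trans (+-congˡ Dv*Z≈0) (+-identityʳ _) ⟩
    S v * P + (D v * P + S v * Z)
      ≈⟨ +-congˡ (+-cong (*-congˡ (reflexive (≡.cong (ΠL S) (≡.sym (≡.trans (remove-head v us) (remove-fresh v us v∉us))))))
                         Sv*Z) ⟩
    S v * P + (D v * ΠL S (remove v (v ∷ us)) + ΣL (λ u → D u * ΠL S (remove u (v ∷ us))) us) ∎
    where
    P = ΠL S us
    Z = ΣL (λ u → D u * ΠL S (remove u us)) us
    Dv*Z≈0 : D v * Z ≈ 0#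
    Dv*Z≈0 = trans (*-distribˡ-ΣL _ _ us) (ΣL-zero _ us (λ u u∈us →
      trans (sym (*-assoc _ _ _)) (trans (*-congʳ (DD≈0 (here ≡.refl) (there u∈us) (λ { ≡.refl → Allₚ.All¬⇒¬Any v∉us u∈us })))
                                         (zeroˡ _))))
    Sv*Z : S v * Z ≈ ΣL (λ u → D u * ΠL S (remove u (v ∷ us))) us
    Sv*Z = trans (*-distribˡ-ΣL _ _ us) (ΣL-cong us (λ u u∈us → begin
      S v * (D u * ΠL S (remove u us))  ≈⟨ solve 3 (λ s d p → s :* (d :* p) := d :* (s :* p)) refl (S v) (D u) _ ⟩
      D u * (S v * ΠL S (remove u us))  ≡⟨ ≡.cong (λ ws → D u * ΠL S ws) (remove-other u v us (λ { ≡.refl → Allₚ.All¬⇒¬Any v∉us u∈us })) ⟨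
      D u * ΠL S (remove u (v ∷ us))    ∎))

  -- Each u ∈ us chooses a weighted item (l, c) from an L × r grid, placed at position code u l c.
  module Choices (r L : ℕ) (code : ℕ → ℕ → ℕ → ℕ) (w : ℕ → ℕ → Carrier) where

    ΣΣ : (ℕ → ℕ → Carrier) → Carrier
    ΣΣ f = Σ L (λ l → Σ r (f l))

    ΣΣ-cong : ∀ {f g} → (∀ l c → f l c ≈ g l c) → ΣΣ f ≈ ΣΣ g
    ΣΣ-cong h = Σ-cong L (λ l → Σ-cong r (h l))

    ΣΣ-distrib-+ : ∀ f g → ΣΣ (λ l c → f l c + g l c) ≈ ΣΣ f + ΣΣ g
    ΣΣ-distrib-+ f g = trans (Σ-cong L (λ l → Σ-distrib-+ r _ _)) (Σ-distrib-+ L _ _)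

    *-distribʳ-ΣΣ : ∀ f x → ΣΣ f * x ≈ ΣΣ (λ l c → f l c * x)
    *-distribʳ-ΣΣ f x = trans (*-distribʳ-Σ L _ x) (Σ-cong L (λ l → *-distribʳ-Σ r _ x))

    ΣΣ-zero : ∀ f → (∀ l c → l < L → c < r → f l c ≈ 0#) → ΣΣ f ≈ 0#
    ΣΣ-zero f h = Σ-zero L _ (λ l l<L → Σ-zero r _ (λ c c<r → h l c l<L c<r))

    below : ℕ → ℕ → Carrier
    below u T = ΣΣ (λ l c → when ⌊ code u l c <? T ⌋ (w l c))

    at : ℕ → ℕ → Carrier
    at u T = ΣΣ (λ l c → when ⌊ code u l c ≟ T ⌋ (w l c))

    Injective : List ℕ → Set
    Injective us = ∀ {u v l c l′ c′} → u ∈ us → v ∈ us → l < L → c < r → l′ < L → c′ < r →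
                   code u l c ≡ code v l′ c′ → u ≡ v

    -- all choices below T, grouped by the member making the largest choice
    byMaximum : List ℕ → ℕ → Carrier
    byMaximum us T = ΣL (λ v → ΣΣ (λ l c → when ⌊ code v l c <? T ⌋ (w l c * ΠL (λ u → below u (code v l c)) (remove v us)))) us

    when-<-suc : ∀ p T x → when ⌊ p <? suc T ⌋ x ≈ when ⌊ p <? T ⌋ x + when ⌊ p ≟ T ⌋ x
    when-<-suc p T x with p <? suc T | p <? T | p ≟ T
    ... | yes _ | yes _ | no _ = sym (+-identityʳ x)
    ... | yes _ | no _ | yes _ = sym (+-identityˡ x)
    ... | no _ | no _ | no _ = sym (+-identityʳ 0#)
    ... | yes _ | yes p<T | yes ≡.refl = ⊥-elim (ℕ.<-irrefl ≡.refl p<T)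
    ... | yes p<1+T | no p≮T | no p≢T = ⊥-elim (p≢T (ℕ.≤-antisym (ℕ.≤-pred p<1+T) (ℕ.≮⇒≥ p≮T)))
    ... | no p≮1+T | yes p<T | _ = ⊥-elim (p≮1+T (ℕ.m<n⇒m<1+n p<T))
    ... | no p≮1+T | no _ | yes ≡.refl = ⊥-elim (p≮1+T ℕ.≤-refl)

    when-≟-* : ∀ p T x (F : ℕ → Carrier) → when ⌊ p ≟ T ⌋ (x * F p) ≈ when ⌊ p ≟ T ⌋ x * F T
    when-≟-* p T x F with p ≟ T
    ... | yes ≡.refl = refl
    ... | no _ = sym (zeroˡ _)

    below-suc : ∀ u T → below u (suc T) ≈ below u T + at u T
    below-suc u T = trans (ΣΣ-cong (λ l c → when-<-suc _ T _)) (ΣΣ-distrib-+ _ _)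

    at-disjoint : ∀ us T → Injective us → ∀ {u v} → u ∈ us → v ∈ us → u ≢ v → at u T * at v T ≈ 0#
    at-disjoint us T inj {u} {v} u∈ v∈ u≢v = trans (*-distribʳ-ΣΣ _ _) (ΣΣ-zero _ (λ l c l<L c<r →
      trans (*-comm _ _) (trans (*-distribʳ-ΣΣ _ _) (ΣΣ-zero _ (λ l′ c′ l′<L c′<r → both l c l′ c′ l<L c<r l′<L c′<r)))))
      where
      both : ∀ l c l′ c′ → l < L → c < r → l′ < L → c′ < r →
             when ⌊ code v l′ c′ ≟ T ⌋ (w l′ c′) * when ⌊ code u l c ≟ T ⌋ (w l c) ≈ 0#
      both l c l′ c′ l<L c<r l′<L c′<r with code v l′ c′ ≟ T | code u l c ≟ T
      ... | yes e₁ | yes e₂ = ⊥-elim (u≢v (inj u∈ v∈ l<L c<r l′<L c′<r (≡.trans e₂ (≡.sym e₁))))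
      ... | yes _ | no _ = zeroʳ _
      ... | no _ | _ = zeroˡ _

    -- Induction on T: the choices below T + 1 are those below T and those with maximum exactly at T.
    ΠL-below : ∀ us → Unique us → Injective us → ∀ {u₀} → u₀ ∈ us → ∀ T → ΠL (λ u → below u T) us ≈ byMaximum us T
    ΠL-below us us! inj u₀∈ zero = trans (ΠL-zero us u₀∈) (sym (ΣL-zero _ us (λ v _ → ΣΣ-zero _ (λ l c _ _ → refl))))
      where
      ΠL-zero : ∀ us → _ ∈ us → ΠL (λ u → below u zero) us ≈ 0#
      ΠL-zero (u ∷ us) (here ≡.refl) = trans (*-congʳ (ΣΣ-zero _ (λ l c _ _ → refl))) (zeroˡ _)
      ΠL-zero (u ∷ us) (there u₀∈us) = trans (*-congˡ (ΠL-zero us u₀∈us)) (zeroʳ _)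
    ΠL-below us us! inj u₀∈ (suc T) = begin
      ΠL (λ u → below u (suc T)) us
        ≈⟨ ΠL-cong us (λ u _ → below-suc u T) ⟩
      ΠL (λ u → below u T + at u T) us
        ≈⟨ ΠL-binomial (λ u → below u T) (λ u → at u T) us us! (at-disjoint us T inj) ⟩
      ΠL (λ u → below u T) us + ΣL (λ v → at v T * ΠL (λ u → below u T) (remove v us)) us
        ≈⟨ +-cong (ΠL-below us us! inj u₀∈ T) (ΣL-cong us (λ v _ → trans (*-distribʳ-ΣΣ _ _)
             (ΣΣ-cong (λ l c → sym (when-≟-* (code v l c) T (w l c) (λ t → ΠL (λ u → below u t) (remove v us))))))) ⟩
      byMaximum us T + ΣL (λ v → ΣΣ (λ l c → when ⌊ code v l c ≟ T ⌋ (w l c * ΠL (λ u → below u (code v l c)) (remove v us)))) us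
        ≈⟨ ΣL-distrib-+ _ _ us ⟨
      ΣL (λ v → ΣΣ (λ l c → when ⌊ code v l c <? T ⌋ (w l c * ΠL (λ u → below u (code v l c)) (remove v us)))
              + ΣΣ (λ l c → when ⌊ code v l c ≟ T ⌋ (w l c * ΠL (λ u → below u (code v l c)) (remove v us)))) us
        ≈⟨ ΣL-cong us (λ v _ → trans (sym (ΣΣ-distrib-+ _ _)) (ΣΣ-cong (λ l c → sym (when-<-suc _ T _)))) ⟩
      byMaximum us (suc T) ∎

open import Data.Nat using (_+_; _*_)

-- Q.PS is ℕ[[q]] and T.PS is ℕ[[q]][[t]]; Defs.Series is definitionally T.PS, and the operations of
-- Defs agree with those of T up to ≋.
module Q = PowerSeries ℕ.+-*-commutativeSemiring
module QR = CommutativeSemiring Q.PS-commutativeSemiring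
module T = PowerSeries Q.PS-commutativeSemiring
module QΣ = FiniteSum Q.PS-commutativeSemiring
module TR = CommutativeSemiring T.PS-commutativeSemiring
module TΣ = FiniteSum T.PS-commutativeSemiring

q^_ : ℕ → Q.PS
q^ j = Q.monomial j 1

q^-+ : ∀ i j → q^ i Q.⊠ q^ j Q.≋ q^ (i + j)
q^-+ i j = Q.monomial-⊠-monomial i 1 j 1

q^-≡ : ∀ {i j} → i ≡ j → q^ i Q.≋ q^ j
q^-≡ ≡.refl = QR.refl

q^-merge : ∀ {a b c} P → a + b ≡ c → q^ a Q.⊠ (q^ b Q.⊠ P) Q.≋ q^ c Q.⊠ P
q^-merge {a} {b} P a+b≡c =
  QR.trans (QR.sym (Q.⊠-assoc (q^ a) (q^ b) P)) (Q.⊠-congʳ P (QR.trans (q^-+ a b) (q^-≡ a+b≡c)))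

q^-unit : ∀ {e} P → e ≡ 0 → q^ e Q.⊠ P Q.≋ P
q^-unit P ≡.refl = Q.⊠-identityˡ P

Σ≡Σ< : ∀ n f → Q.Σ n f ≡ Σ< n f
Σ≡Σ< zero f = ≡.refl
Σ≡Σ< (suc n) f = ≡.cong (_+ f n) (Σ≡Σ< n f)

Σ-at : ∀ n (F : ℕ → Q.PS) b → T.Σ n F b ≡ Σ< n (λ i → F i b)
Σ-at zero F b = ≡.refl
Σ-at (suc n) F b = ≡.cong (_+ F n b) (Σ-at n F b)

⊛≋⊠ : ∀ f g → f ⊛ g T.≋ f T.⊠ g
⊛≋⊠ f g a b = ≡.trans (Σ<-cong (suc a) (λ i → ≡.sym (Σ≡Σ< (suc b) _))) (≡.sym (Σ-at (suc a) _ b))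
  where
  Σ<-cong : ∀ n {f g : ℕ → ℕ} → (∀ i → f i ≡ g i) → Σ< n f ≡ Σ< n g
  Σ<-cong zero h = ≡.refl
  Σ<-cong (suc n) h = ≡.cong₂ _+_ (Σ<-cong n h) (h n)

mono≋monomial : ∀ i j → mono i j T.≋ T.monomial i (q^ j)
mono≋monomial i j a b with a ≟ i
... | yes _ = ≡.refl
... | no _ = ≡.refl

sumS≋Σ : ∀ n F → sumS n F T.≋ TΣ.Σ n F
sumS≋Σ zero F a b = ≡.refl
sumS≋Σ (suc n) F a b = ≡.cong (_+ F n a b) (sumS≋Σ n F a b)

prodS≋Π : ∀ n F → prodS n F T.≋ TΣ.Π n F
prodS≋Π zero F = mono≋monomial 0 0
prodS≋Π (suc n) F = TR.trans (⊛≋⊠ (prodS n F) (F n)) (T.⊠-cong (prodS≋Π n F) (TR.refl {F n}))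

sumL≋ΣL : ∀ {X : Set} (f : X → Series) xs → sumL (map f xs) T.≋ TΣ.ΣL f xs
sumL≋ΣL f [] a b = ≡.refl
sumL≋ΣL f (x ∷ xs) a b = ≡.cong (f x a b +_) (sumL≋ΣL f xs a b)

Σ-apply : ∀ n (F : ℕ → T.PS) a → TΣ.Σ n F a Q.≋ QΣ.Σ n (λ k → F k a)
Σ-apply zero F a = QR.refl
Σ-apply (suc n) F a = Q.⊞-congʳ (F n a) (Σ-apply n F a)

mono-⊠-mono : ∀ i j k l → mono i j T.⊠ mono k l T.≋ mono (i + k) (j + l)
mono-⊠-mono i j k l = TR.trans (T.⊠-cong (mono≋monomial i j) (mono≋monomial k l))
  (TR.trans (T.monomial-⊠-monomial i (q^ j) k (q^ l))
  (TR.trans (T.monomial-cong (i + k) (Q.monomial-⊠-monomial j 1 l 1)) (TR.sym (mono≋monomial (i + k) (j + l)))))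

mono-≡ : ∀ {i i′ j j′} → i ≡ i′ → j ≡ j′ → mono i j T.≋ mono i′ j′
mono-≡ ≡.refl ≡.refl = TR.refl

ΣL-apply : ∀ {X : Set} (F : X → T.PS) xs a → TΣ.ΣL F xs a Q.≋ QΣ.ΣL (λ x → F x a) xs
ΣL-apply F [] a = QR.refl
ΣL-apply F (x ∷ xs) a = Q.⊞-congˡ (F x a) (ΣL-apply F xs a)

-- Coloured words and their descent generating functions

module _ {A : Set} where

  filterᵇ-∷ : ∀ (P : A → Bool) x xs → filterᵇ P (x ∷ xs) ≡ (if P x then x ∷ filterᵇ P xs else filterᵇ P xs)
  filterᵇ-∷ P x xs with P x
  ... | true = ≡.refl
  ... | false = ≡.refl

  filterᵇ-cong : ∀ {P P′ : A → Bool} xs → (∀ x → P x ≡ P′ x) → filterᵇ P xs ≡ filterᵇ P′ xs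
  filterᵇ-cong [] h = ≡.refl
  filterᵇ-cong {P} {P′} (x ∷ xs) h with P x | P′ x | h x
  ... | true | true | ≡.refl = ≡.cong (x ∷_) (filterᵇ-cong xs h)
  ... | false | false | ≡.refl = filterᵇ-cong xs h

  filterᵇ-const : ∀ b xs → filterᵇ (λ (_ : A) → b) xs ≡ (if b then xs else [])
  filterᵇ-const true [] = ≡.refl
  filterᵇ-const true (x ∷ xs) = ≡.cong (x ∷_) (filterᵇ-const true xs)
  filterᵇ-const false [] = ≡.refl
  filterᵇ-const false (x ∷ xs) = filterᵇ-const false xs

  filterᵇ-∧ : ∀ (P Q : A → Bool) xs → filterᵇ (λ x → P x ∧ Q x) xs ≡ filterᵇ Q (filterᵇ P xs)
  filterᵇ-∧ P Q [] = ≡.refl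
  filterᵇ-∧ P Q (x ∷ xs) with P x
  ... | false = filterᵇ-∧ P Q xs
  ... | true with Q x
  ...   | true = ≡.cong (x ∷_) (filterᵇ-∧ P Q xs)
  ...   | false = filterᵇ-∧ P Q xs

  filterᵇ-const-∧ : ∀ b (P : A → Bool) xs → filterᵇ (λ x → b ∧ P x) xs ≡ (if b then filterᵇ P xs else [])
  filterᵇ-const-∧ true P xs = ≡.refl
  filterᵇ-const-∧ false P xs = filterᵇ-const false xs

module _ {A B : Set} where

  filterᵇ-map : ∀ (P : B → Bool) (f : A → B) xs → filterᵇ P (map f xs) ≡ map f (filterᵇ (P ∘ f) xs)
  filterᵇ-map P f [] = ≡.refl
  filterᵇ-map P f (x ∷ xs) with P (f x)
  ... | true = ≡.cong (f x ∷_) (filterᵇ-map P f xs)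
  ... | false = filterᵇ-map P f xs

  filterᵇ-concatMap : ∀ (P : B → Bool) (g : A → List B) xs →
    filterᵇ P (concatMap g xs) ≡ concatMap (filterᵇ P ∘ g) xs
  filterᵇ-concatMap P g [] = ≡.refl
  filterᵇ-concatMap P g (x ∷ xs) =
    ≡.trans (List.filter-++ (T? ∘ P) (g x) (concatMap g xs)) (≡.cong (filterᵇ P (g x) ++_) (filterᵇ-concatMap P g xs))

  concatMap-filterᵇ : ∀ (g : A → List B) P xs → concatMap g (filterᵇ P xs) ≡ concatMap (λ x → if P x then g x else []) xs
  concatMap-filterᵇ g P [] = ≡.refl
  concatMap-filterᵇ g P (x ∷ xs) with P x
  ... | true = ≡.cong (g x ++_) (concatMap-filterᵇ g P xs)
  ... | false = concatMap-filterᵇ g P xs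

coloured : ℕ → List ℕ → List Letter
coloured r vs = cartesianProduct vs (upTo r)

distinct : List Letter → Bool
distinct w = distinctᵇ (map proj₁ w)

injWords : ℕ → ℕ → List ℕ → List (List Letter)
injWords r m vs = filterᵇ distinct (words m (coloured r vs))

avoids : ℕ → List Letter → Bool
avoids v w = not (elemᵇ v (map proj₁ w))

differs : ℕ → Letter → Bool
differs v y = not ⌊ v ≟ proj₁ y ⌋

avoids-∷ : ∀ v y w → avoids v (y ∷ w) ≡ differs v y ∧ avoids v w
avoids-∷ v y w with ⌊ v ≟ proj₁ y ⌋
... | true = ≡.refl
... | false = ≡.refl

words-avoiding : ∀ v m L → filterᵇ (avoids v) (words m L) ≡ words m (filterᵇ (differs v) L)
words-avoiding v zero L = ≡.refl
words-avoiding v (suc m) L = begin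
  filterᵇ (avoids v) (concatMap (λ y → map (y ∷_) (words m L)) L)
    ≡⟨ filterᵇ-concatMap (avoids v) _ L ⟩
  concatMap (λ y → filterᵇ (avoids v) (map (y ∷_) (words m L))) L
    ≡⟨ List.concatMap-cong first-letter L ⟩
  concatMap (λ y → if differs v y then map (y ∷_) (words m (filterᵇ (differs v) L)) else []) L
    ≡⟨ concatMap-filterᵇ (λ y → map (y ∷_) (words m (filterᵇ (differs v) L))) (differs v) L ⟨
  words (suc m) (filterᵇ (differs v) L) ∎
  where
  open ≡.≡-Reasoning
  first-letter : ∀ y → filterᵇ (avoids v) (map (y ∷_) (words m L)) ≡
                       (if differs v y then map (y ∷_) (words m (filterᵇ (differs v) L)) else [])
  first-letter y = begin
    filterᵇ (avoids v) (map (y ∷_) (words m L))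
      ≡⟨ filterᵇ-map (avoids v) (y ∷_) (words m L) ⟩
    map (y ∷_) (filterᵇ (avoids v ∘ (y ∷_)) (words m L))
      ≡⟨ ≡.cong (map (y ∷_)) (≡.trans (filterᵇ-cong (words m L) (avoids-∷ v y))
                                      (filterᵇ-const-∧ (differs v y) (avoids v) (words m L))) ⟩
    map (y ∷_) (if differs v y then filterᵇ (avoids v) (words m L) else [])
      ≡⟨ push (differs v y) ⟩
    (if differs v y then map (y ∷_) (words m (filterᵇ (differs v) L)) else []) ∎
    where
    push : ∀ b → map (y ∷_) (if b then filterᵇ (avoids v) (words m L) else []) ≡
                 (if b then map (y ∷_) (words m (filterᵇ (differs v) L)) else [])
    push true = ≡.cong (map (y ∷_)) (words-avoiding v m L)
    push false = ≡.refl

coloured-remove : ∀ r v vs → filterᵇ (differs v) (coloured r vs) ≡ coloured r (remove v vs)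
coloured-remove r v [] = ≡.refl
coloured-remove r v (u ∷ vs) = begin
  filterᵇ (differs v) (map (u ,_) (upTo r) ++ coloured r vs)
    ≡⟨ List.filter-++ (T? ∘ differs v) (map (u ,_) (upTo r)) (coloured r vs) ⟩
  filterᵇ (differs v) (map (u ,_) (upTo r)) ++ filterᵇ (differs v) (coloured r vs)
    ≡⟨ ≡.cong₂ _++_ (≡.trans (filterᵇ-map (differs v) (u ,_) (upTo r)) (≡.cong (map (u ,_)) (filterᵇ-const b (upTo r))))
                    (coloured-remove r v vs) ⟩
  map (u ,_) (if b then upTo r else []) ++ coloured r (remove v vs)
    ≡⟨ distribute b ⟩
  coloured r (if b then u ∷ remove v vs else remove v vs)
    ≡⟨ ≡.cong (coloured r) (filterᵇ-∷ (λ u → not ⌊ v ≟ u ⌋) u vs) ⟨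
  coloured r (remove v (u ∷ vs)) ∎
  where
  open ≡.≡-Reasoning
  b : Bool
  b = not ⌊ v ≟ u ⌋
  distribute : ∀ b → map (u ,_) (if b then upTo r else []) ++ coloured r (remove v vs) ≡
                     coloured r (if b then u ∷ remove v vs else remove v vs)
  distribute true = ≡.refl
  distribute false = ≡.refl

injWords-suc : ∀ r m vs →
  injWords r (suc m) vs ≡ concatMap (λ x → map (x ∷_) (injWords r m (remove (proj₁ x) vs))) (coloured r vs)
injWords-suc r m vs = ≡.trans (filterᵇ-concatMap distinct _ (coloured r vs)) (List.concatMap-cong first-letter (coloured r vs))
  where
  open ≡.≡-Reasoning
  first-letter : ∀ x → filterᵇ distinct (map (x ∷_) (words m (coloured r vs))) ≡
                       map (x ∷_) (injWords r m (remove (proj₁ x) vs))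
  first-letter x = begin
    filterᵇ distinct (map (x ∷_) (words m (coloured r vs)))
      ≡⟨ filterᵇ-map distinct (x ∷_) (words m (coloured r vs)) ⟩
    map (x ∷_) (filterᵇ (λ w → avoids (proj₁ x) w ∧ distinct w) (words m (coloured r vs)))
      ≡⟨ ≡.cong (map (x ∷_)) (filterᵇ-∧ (avoids (proj₁ x)) distinct (words m (coloured r vs))) ⟩
    map (x ∷_) (filterᵇ distinct (filterᵇ (avoids (proj₁ x)) (words m (coloured r vs))))
      ≡⟨ ≡.cong (map (x ∷_) ∘ filterᵇ distinct) (words-avoiding (proj₁ x) m (coloured r vs)) ⟩
    map (x ∷_) (filterᵇ distinct (words m (filterᵇ (differs (proj₁ x)) (coloured r vs))))
      ≡⟨ ≡.cong (map (x ∷_) ∘ filterᵇ distinct ∘ words m) (coloured-remove r (proj₁ x) vs) ⟩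
    map (x ∷_) (injWords r m (remove (proj₁ x) vs)) ∎

bit : Bool → ℕ
bit b = if b then 1 else 0

descent : Letter → Letter → ℕ
descent p x = bit (p >ᵇ x)

-- t^des q^fmaj of a word read from position s onwards, preceded by the letter p
descWeight : ℕ → ℕ → Letter → List Letter → Series
descWeight r s p w = mono (length (descFrom s p w)) (r * sum (descFrom s p w) + sum (map proj₂ w))

descWeight-∷ : ∀ r s p x w →
  descWeight r s p (x ∷ w) T.≋ mono (descent p x) (r * s * descent p x + proj₂ x) T.⊠ descWeight r (suc s) x w
descWeight-∷ r s p x w with p >ᵇ x
... | true = TR.sym (TR.trans (mono-⊠-mono 1 _ _ _) (mono-≡ ≡.refl (exponent r s _ (proj₂ x) _)))
  where
  exponent : ∀ r s d c C → r * s * 1 + c + (r * d + C) ≡ r * (s + d) + (c + C)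
  exponent = solve-∀
... | false = TR.sym (TR.trans (mono-⊠-mono 0 _ _ _) (mono-≡ ≡.refl (exponent r s _ (proj₂ x) _)))
  where
  exponent : ∀ r s d c C → r * s * 0 + c + (r * d + C) ≡ r * d + (c + C)
  exponent = solve-∀

descGF : ℕ → ℕ → List ℕ → Letter → ℕ → Series
descGF r m vs p s = TΣ.ΣL (descWeight r s p) (injWords r m vs)

A≋descGF : ∀ r n → A r n T.≋ descGF r n (map suc (upTo n)) (0 , 0) 0
A≋descGF r n = sumL≋ΣL (descWeight r 0 (0 , 0)) (injWords r n (map suc (upTo n)))

descGF-suc : ∀ r m vs p s → descGF r (suc m) vs p s T.≋
  TΣ.ΣL (λ x → mono (descent p x) (r * s * descent p x + proj₂ x) T.⊠ descGF r m (remove (proj₁ x) vs) x (suc s)) (coloured r vs)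
descGF-suc r m vs p s =
  TR.trans (TR.reflexive (≡.cong (TΣ.ΣL (descWeight r s p)) (injWords-suc r m vs)))
  (TR.trans (TΣ.ΣL-concatMap (descWeight r s p) (λ x → map (x ∷_) (injWords r m (remove (proj₁ x) vs))) (coloured r vs))
  (TΣ.ΣL-cong (coloured r vs) (λ x _ → let ws = injWords r m (remove (proj₁ x) vs) in
    TR.trans (TΣ.ΣL-map (descWeight r s p) (x ∷_) ws)
    (TR.trans (TΣ.ΣL-cong ws (λ w _ → descWeight-∷ r s p x w))
              (TR.sym (TΣ.*-distribˡ-ΣL (mono (descent p x) (r * s * descent p x + proj₂ x)) (descWeight r (suc s) x) ws))))))

-- Coding barred letters by natural numbers

isYes-cong : ∀ {P Q : Set} (p? : Dec P) (q? : Dec Q) → (P → Q) → (Q → P) → ⌊ p? ⌋ ≡ ⌊ q? ⌋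
isYes-cong (yes _) (yes _) _ _ = ≡.refl
isYes-cong (no _) (no _) _ _ = ≡.refl
isYes-cong (yes p) (no ¬q) f _ = ⊥-elim (¬q (f p))
isYes-cong (no ¬p) (yes q) _ g = ⊥-elim (¬p (g q))

isYes⇒ : ∀ {P : Set} (p? : Dec P) → ⌊ p? ⌋ ≡ true → P
isYes⇒ (yes p) _ = p

isYes⇐ : ∀ {P : Set} (p? : Dec P) → P → ⌊ p? ⌋ ≡ true
isYes⇐ (yes _) _ = ≡.refl
isYes⇐ (no ¬p) p = ⊥-elim (¬p p)

radix-< : ∀ B {l a x y} → x < B → l < a → l * B + x < a * B + y
radix-< B {l} {a} {x} {y} x<B l<a = begin-strict
  l * B + x  <⟨ ℕ.+-monoʳ-< (l * B) x<B ⟩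
  l * B + B  ≡⟨ ℕ.+-comm (l * B) B ⟩
  suc l * B  ≤⟨ ℕ.*-monoˡ-≤ B l<a ⟩
  a * B      ≤⟨ ℕ.m≤m+n (a * B) y ⟩
  a * B + y  ∎
  where open ℕ.≤-Reasoning

radix-≤⇐ : ∀ B {l a x y} → x < B → l < a ⊎ (l ≡ a × x ≤ y) → l * B + x ≤ a * B + y
radix-≤⇐ B x<B (inj₁ l<a) = ℕ.<⇒≤ (radix-< B x<B l<a)
radix-≤⇐ B {l} x<B (inj₂ (≡.refl , x≤y)) = ℕ.+-monoʳ-≤ (l * B) x≤y

radix-<⇐ : ∀ B {l a x y} → x < B → l < a ⊎ (l ≡ a × x < y) → l * B + x < a * B + y
radix-<⇐ B x<B (inj₁ l<a) = radix-< B x<B l<a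
radix-<⇐ B {l} x<B (inj₂ (≡.refl , x<y)) = ℕ.+-monoʳ-< (l * B) x<y

radix-≤⇒ : ∀ B {l a x y} → y < B → l * B + x ≤ a * B + y → l < a ⊎ (l ≡ a × x ≤ y)
radix-≤⇒ B {l} {a} {x} {y} y<B le with ℕ.<-cmp l a
... | tri< l<a _ _ = inj₁ l<a
... | tri≈ _ ≡.refl _ = inj₂ (≡.refl , ℕ.+-cancelˡ-≤ (l * B) x y le)
... | tri> _ _ a<l = ⊥-elim (ℕ.<⇒≱ (radix-< B y<B a<l) le)

radix-<⇒ : ∀ B {l a x y} → y < B → l * B + x < a * B + y → l < a ⊎ (l ≡ a × x < y)
radix-<⇒ B {l} {a} {x} {y} y<B lt with ℕ.<-cmp l a
... | tri< l<a _ _ = inj₁ l<a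
... | tri≈ _ ≡.refl _ = inj₂ (≡.refl , ℕ.+-cancelˡ-< (l * B) x y lt)
... | tri> _ _ a<l = ⊥-elim (ℕ.<-asym lt (radix-< B y<B a<l))

radix-injective : ∀ B {l a x y} → x < B → y < B → l * B + x ≡ a * B + y → l ≡ a × x ≡ y
radix-injective B {l} {a} {x} {y} x<B y<B eq
  with radix-≤⇒ B {l} {a} y<B (ℕ.≤-reflexive eq) | radix-≤⇒ B {a} {l} x<B (ℕ.≤-reflexive (≡.sym eq))
... | inj₁ l<a | inj₁ a<l = ⊥-elim (ℕ.<-asym l<a a<l)
... | inj₁ l<a | inj₂ (≡.refl , _) = ⊥-elim (ℕ.<-irrefl ≡.refl l<a)
... | inj₂ (≡.refl , _) | inj₁ a<l = ⊥-elim (ℕ.<-irrefl ≡.refl a<l)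
... | inj₂ (≡.refl , x≤y) | inj₂ (_ , y≤x) = ≡.refl , ℕ.≤-antisym x≤y y≤x

-- Barred letters (level l, letter y), listed level by level and, within a level, downwards in the
-- letter order, get consecutive codes l * width + corank y.
module Coding (r N : ℕ) where

  width : ℕ
  width = N * r + N

  rank : Letter → ℕ
  rank (v , zero) = N * r + v
  rank (v , suc c) = N * r ∸ suc (v * r + suc c)

  corank : Letter → ℕ
  corank y = width ∸ suc (rank y)

  code : ℕ → ℕ → ℕ → ℕ
  code v l c = l * width + corank (v , c)

  Valid : Letter → Set
  Valid (v , c) = v < N × c < r

  private
    coloured-index< : ∀ {v c} → v < N → suc c < r → suc (v * r + suc c) ≤ N * r
    coloured-index< {v} {c} v<N c<r = begin
      suc (v * r + suc c)  ≡⟨ ℕ.+-suc (v * r) (suc c) ⟨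
      v * r + suc (suc c)  ≤⟨ ℕ.+-monoʳ-≤ (v * r) c<r ⟩
      v * r + r            ≡⟨ ℕ.+-comm (v * r) r ⟩
      suc v * r            ≤⟨ ℕ.*-monoˡ-≤ r v<N ⟩
      N * r                ∎
      where open ℕ.≤-Reasoning

    rank-coloured< : ∀ {v c} → v < N → suc c < r → rank (v , suc c) < N * r
    rank-coloured< {v} {c} v<N c<r = ℕ.∸-monoʳ-< {N * r} {suc (v * r + suc c)} {0} (s≤s z≤n) (coloured-index< v<N c<r)

  rank<width : ∀ y → Valid y → rank y < width
  rank<width (v , zero) (v<N , _) = ℕ.+-monoʳ-< (N * r) v<N
  rank<width (v , suc c) (v<N , c<r) = ℕ.<-≤-trans (rank-coloured< v<N c<r) (ℕ.m≤m+n (N * r) N)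

  corank<width : ∀ y → Valid y → corank y < width
  corank<width y vy = ℕ.∸-monoʳ-< {width} {suc (rank y)} {0} (s≤s z≤n) (rank<width y vy)

  >ᵇ⇒rank-< : ∀ x y → Valid x → Valid y → x >ᵇ y ≡ true → rank y < rank x
  >ᵇ⇒rank-< (a , zero) (b , zero) _ _ x>y = ℕ.+-monoʳ-< (N * r) (isYes⇒ (b <? a) x>y)
  >ᵇ⇒rank-< (a , zero) (b , suc w) _ (b<N , w<r) _ = ℕ.<-≤-trans (rank-coloured< b<N w<r) (ℕ.m≤m+n (N * r) a)
  >ᵇ⇒rank-< (a , suc z) (b , suc w) (a<N , z<r) (b<N , w<r) x>y =
    ℕ.∸-monoʳ-< (s≤s (index< x>y)) (coloured-index< b<N w<r)
    where
    index< : ⌊ a <? b ⌋ ∨ (⌊ a ≟ b ⌋ ∧ ⌊ z <? w ⌋) ≡ true → a * r + suc z < b * r + suc w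
    index< h with a <? b | a ≟ b | z <? w
    ... | yes a<b | _ | _ = radix-<⇐ r {a} {b} z<r (inj₁ a<b)
    ... | no _ | yes ≡.refl | yes z<w = radix-<⇐ r {a} {a} z<r (inj₂ (≡.refl , s≤s z<w))

  rank-<⇒>ᵇ : ∀ x y → Valid x → Valid y → rank y < rank x → x >ᵇ y ≡ true
  rank-<⇒>ᵇ (a , zero) (b , zero) _ _ lt = isYes⇐ (b <? a) (ℕ.+-cancelˡ-< (N * r) b a lt)
  rank-<⇒>ᵇ (a , zero) (b , suc w) _ _ _ = ≡.refl
  rank-<⇒>ᵇ (a , suc z) (b , zero) (a<N , z<r) _ lt =
    ⊥-elim (ℕ.<-asym (ℕ.<-≤-trans (rank-coloured< a<N z<r) (ℕ.m≤m+n (N * r) b)) lt)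
  rank-<⇒>ᵇ (a , suc z) (b , suc w) (a<N , z<r) (b<N , w<r) lt
    with radix-<⇒ r {a} {b} {suc z} {suc w} w<r
           (ℕ.≤-pred (ℕ.∸-cancelʳ-< {suc (b * r + suc w)} {suc (a * r + suc z)} {N * r} lt))
  ... | inj₁ a<b = ≡.cong (λ t → t ∨ (⌊ a ≟ b ⌋ ∧ ⌊ z <? w ⌋)) (isYes⇐ (a <? b) a<b)
  ... | inj₂ (≡.refl , s≤s z<w) with a <? a
  ...   | yes _ = ≡.refl
  ...   | no _ = ≡.cong₂ _∧_ (isYes⇐ (a ≟ a) ≡.refl) (isYes⇐ (z <? w) z<w)

  corank-≤⇒ : ∀ x y → Valid y → corank x ≤ corank y → rank y ≤ rank x
  corank-≤⇒ x y vy le with ℕ.≤-<-connex (rank y) (rank x)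
  ... | inj₁ ry≤rx = ry≤rx
  ... | inj₂ rx<ry = ⊥-elim (ℕ.<⇒≱ (ℕ.∸-monoʳ-< (s≤s rx<ry) (rank<width y vy)) le)

  corank-≤⇐ : ∀ x y → rank y ≤ rank x → corank x ≤ corank y
  corank-≤⇐ x y le = ℕ.∸-monoʳ-≤ width (s≤s le)

  -- This is where descents enter: a letter x with p > x must sit at a lower level than p.
  code-below : ∀ p x → Valid p → Valid x → ∀ l a →
    ⌊ l * width + corank x <? suc (a * width + corank p) ⌋ ≡ ⌊ l <? suc a ∸ descent p x ⌋
  code-below p x vp vx l a = below (p >ᵇ x) ≡.refl
    where
    below : ∀ b → p >ᵇ x ≡ b → ⌊ l * width + corank x <? suc (a * width + corank p) ⌋ ≡ ⌊ l <? suc a ∸ (if b then 1 else 0) ⌋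
    below true p>x = isYes-cong (_ <? _) (l <? a) ⇒ ⇐
      where
      ⇒ : l * width + corank x < suc (a * width + corank p) → l < a
      ⇒ lt with radix-≤⇒ width {l} {a} (corank<width p vp) (ℕ.≤-pred lt)
      ... | inj₁ l<a = l<a
      ... | inj₂ (≡.refl , cx≤cp) = ⊥-elim (ℕ.<⇒≱ (>ᵇ⇒rank-< p x vp vx p>x) (corank-≤⇒ x p vp cx≤cp))
      ⇐ : l < a → l * width + corank x < suc (a * width + corank p)
      ⇐ l<a = s≤s (radix-≤⇐ width {l} {a} (corank<width x vx) (inj₁ l<a))
    below false p≯x = isYes-cong (_ <? _) (l <? suc a) ⇒ ⇐
      where
      ⇒ : l * width + corank x < suc (a * width + corank p) → l < suc a
      ⇒ lt with radix-≤⇒ width {l} {a} (corank<width p vp) (ℕ.≤-pred lt)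
      ... | inj₁ l<a = ℕ.m<n⇒m<1+n l<a
      ... | inj₂ (≡.refl , _) = ℕ.≤-refl
      ⇐ : l < suc a → l * width + corank x < suc (a * width + corank p)
      ⇐ l<1+a with ℕ.m<1+n⇒m<n∨m≡n l<1+a
      ... | inj₁ l<a = s≤s (radix-≤⇐ width {l} {a} (corank<width x vx) (inj₁ l<a))
      ... | inj₂ ≡.refl = s≤s (radix-≤⇐ width {l} {l} (corank<width x vx) (inj₂ (≡.refl , corank-≤⇐ x p
              (ℕ.≮⇒≥ (λ rp<rx → true≢false (≡.trans (≡.sym (rank-<⇒>ᵇ p x vp vx rp<rx)) p≯x))))))
        where
        true≢false : true ≡ false → ⊥
        true≢false ()

  rank-injective : ∀ u c v c′ → Valid (u , c) → Valid (v , c′) → rank (u , c) ≡ rank (v , c′) → u ≡ v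
  rank-injective u zero v zero _ _ eq = ℕ.+-cancelˡ-≡ (N * r) u v eq
  rank-injective u zero v (suc c′) _ (v<N , c′<r) eq =
    ⊥-elim (ℕ.<⇒≱ (rank-coloured< v<N c′<r) (≡.subst (N * r ≤_) eq (ℕ.m≤m+n (N * r) u)))
  rank-injective u (suc c) v zero (u<N , c<r) _ eq =
    ⊥-elim (ℕ.<⇒≱ (rank-coloured< u<N c<r) (≡.subst (N * r ≤_) (≡.sym eq) (ℕ.m≤m+n (N * r) v)))
  rank-injective u (suc c) v (suc c′) (u<N , c<r) (v<N , c′<r) eq =
    proj₁ (radix-injective r {u} {v} c<r c′<r
      (ℕ.suc-injective (ℕ.∸-cancelˡ-≡ (coloured-index< u<N c<r) (coloured-index< v<N c′<r) eq)))

  code-injective : ∀ u c v c′ l l′ → Valid (u , c) → Valid (v , c′) → code u l c ≡ code v l′ c′ → u ≡ v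
  code-injective u c v c′ l l′ vu vv eq = rank-injective u c v c′ vu vv (ℕ.suc-injective
    (ℕ.∸-cancelˡ-≡ (rank<width (u , c) vu) (rank<width (v , c′) vv)
      (proj₂ (radix-injective width {l} {l′} (corank<width (u , c) vu) (corank<width (v , c′) vv) eq))))

-- q-analogues and the right-hand side

binom2-suc : ∀ k → suc (suc k) C 2 ≡ suc k + suc k C 2
binom2-suc k = ≡.trans (≡.sym (nCk+nC[k+1]≡[n+1]C[k+1] (suc k) 1)) (≡.cong (_+ suc k C 2) (nC1≡n (suc k)))

expo-zero : ∀ r → expo r 0 ≡ 0
expo-zero r = ≡.trans (≡.cong (_∸ r * 0) (ℕ.+-identityʳ (r * 0))) (ℕ.n∸n≡0 (r * 0))

-- expo r k is r (k+1 choose 2) + (1 - r) k written with truncated subtraction; the subtraction never truncates.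
expo-+ : ∀ r k → expo r k + r * k ≡ r * (suc k C 2) + k
expo-+ r k = ℕ.m∸n+n≡m (ℕ.≤-trans (ℕ.*-monoʳ-≤ r (k≤binom2 k)) (ℕ.m≤m+n (r * (suc k C 2)) k))
  where
  k≤binom2 : ∀ k → k ≤ suc k C 2
  k≤binom2 zero = z≤n
  k≤binom2 (suc k) = ≡.subst (suc k ≤_) (≡.sym (binom2-suc k)) (ℕ.m≤m+n (suc k) _)

expo-suc : ∀ r k → expo r (suc k) ≡ expo r k + (r * k + 1)
expo-suc r k = ℕ.+-cancelʳ-≡ (r * suc k) _ _ (begin
  expo r (suc k) + r * suc k                ≡⟨ expo-+ r (suc k) ⟩
  r * (suc (suc k) C 2) + suc k             ≡⟨ ≡.cong (λ c → r * c + suc k) (binom2-suc k) ⟩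
  r * (suc k + suc k C 2) + suc k           ≡⟨ identity r k (suc k C 2) ⟩
  (r * (suc k C 2) + k) + (r * k + 1 + r)   ≡⟨ ≡.cong (_+ (r * k + 1 + r)) (expo-+ r k) ⟨
  (expo r k + r * k) + (r * k + 1 + r)      ≡⟨ identity′ r k (expo r k) ⟩
  expo r k + (r * k + 1) + r * suc k        ∎)
  where
  open ≡.≡-Reasoning
  identity : ∀ r k c → r * (suc k + c) + suc k ≡ (r * c + k) + (r * k + 1 + r)
  identity = solve-∀
  identity′ : ∀ r k e → (e + r * k) + (r * k + 1 + r) ≡ e + (r * k + 1) + r * suc k
  identity′ = solve-∀

open import Relation.Binary.Reasoning.Setoid QR.setoid

qInt : ℕ → ℕ → Q.PS
qInt s k = QΣ.Σ k (λ j → q^ (s * j))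

qFact : ℕ → ℕ → Q.PS
qFact s k = QΣ.Π k (λ i → qInt s (suc i))

pow : ℕ → Q.PS → Q.PS
pow k u = QΣ.Π k (λ _ → u)

Stirling : ℕ → ℕ → ℕ → Q.PS
Stirling r zero zero = Q.𝟙
Stirling r zero (suc k) = Q.𝟘
Stirling r (suc n) zero = qInt 1 1 Q.⊠ Stirling r n zero
Stirling r (suc n) (suc k) = Stirling r n k Q.⊞ qInt 1 (r * suc k + 1) Q.⊠ Stirling r n (suc k)

qInt-1 : qInt 1 1 Q.≋ Q.𝟙
qInt-1 zero = ≡.refl
qInt-1 (suc b) = ≡.refl

qInt-split : ∀ s x y → qInt s (x + y) Q.≋ qInt s x Q.⊞ q^ (s * x) Q.⊠ qInt s y
qInt-split s x y = begin
  qInt s (x + y)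
    ≈⟨ QΣ.Σ-split x y (λ j → q^ (s * j)) ⟩
  qInt s x Q.⊞ QΣ.Σ y (λ i → q^ (s * (x + i)))
    ≈⟨ QR.+-congˡ (QΣ.Σ-cong y (λ i → QR.trans (q^-≡ (ℕ.*-distribˡ-+ s x i)) (QR.sym (q^-+ (s * x) (s * i))))) ⟩
  qInt s x Q.⊞ QΣ.Σ y (λ i → q^ (s * x) Q.⊠ q^ (s * i))
    ≈⟨ QR.+-congˡ (QΣ.*-distribˡ-Σ y (q^ (s * x)) _) ⟨
  qInt s x Q.⊞ q^ (s * x) Q.⊠ qInt s y ∎

qInt-blocks : ∀ r M → qInt 1 (r * M) Q.≋ qInt 1 r Q.⊠ qInt r M
qInt-blocks r M = begin
  qInt 1 (r * M)
    ≈⟨ QΣ.Σ-blocks r M _ ⟩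
  QΣ.Σ M (λ l → QΣ.Σ r (λ c → q^ (1 * (r * l + c))))
    ≈⟨ QΣ.Σ-cong M (λ l → QΣ.Σ-cong r (λ c → QR.trans (q^-≡ (eq l c)) (QR.sym (q^-+ (r * l) (1 * c))))) ⟩
  QΣ.Σ M (λ l → QΣ.Σ r (λ c → q^ (r * l) Q.⊠ q^ (1 * c)))
    ≈⟨ QΣ.Σ-cong M (λ l → QΣ.*-distribˡ-Σ r (q^ (r * l)) _) ⟨
  QΣ.Σ M (λ l → q^ (r * l) Q.⊠ qInt 1 r)
    ≈⟨ QΣ.*-distribʳ-Σ M _ (qInt 1 r) ⟨
  qInt r M Q.⊠ qInt 1 r
    ≈⟨ Q.⊠-comm (qInt r M) (qInt 1 r) ⟩
  qInt 1 r Q.⊠ qInt r M ∎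
  where
  eq : ∀ l c → 1 * (r * l + c) ≡ r * l + 1 * c
  eq l c = ≡.trans (ℕ.*-identityˡ _) (≡.cong (r * l +_) (≡.sym (ℕ.*-identityˡ c)))

qint≋ : ∀ s k → qint s k T.≋ T.monomial 0 (qInt s k)
qint≋ s zero = TR.sym (T.monomial-zero 0 {Q.𝟘} QR.refl)
qint≋ s (suc k) = TR.trans (T.⊞-cong (qint≋ s k) (mono≋monomial 0 (s * k))) (T.monomial-⊞ 0 _ _)

qfact≋ : ∀ s k → qfact s k T.≋ T.monomial 0 (qFact s k)
qfact≋ s zero = mono≋monomial 0 0
qfact≋ s (suc k) = TR.trans (⊛≋⊠ (qfact s k) (qint s (suc k)))
  (TR.trans (T.⊠-cong (qfact≋ s k) (qint≋ s (suc k))) (T.monomial-⊠-constant 0 _ _))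

powS≋ : ∀ k {f u} → f T.≋ T.monomial 0 u → powS k f T.≋ T.monomial 0 (pow k u)
powS≋ zero f≋u = mono≋monomial 0 0
powS≋ (suc k) {f} f≋u = TR.trans (⊛≋⊠ (powS k f) f)
  (TR.trans (T.⊠-cong (powS≋ k f≋u) f≋u) (T.monomial-⊠-constant 0 _ _))

Sr≋ : ∀ r n k → Sr r n k T.≋ T.monomial 0 (Stirling r n k)
Sr≋ r zero zero = mono≋monomial 0 0
Sr≋ r zero (suc k) = TR.sym (T.monomial-zero 0 {Q.𝟘} QR.refl)
Sr≋ r (suc n) zero = TR.trans (⊛≋⊠ (qint 1 1) (Sr r n zero))
  (TR.trans (T.⊠-cong (qint≋ 1 1) (Sr≋ r n zero)) (T.monomial-⊠-constant 0 _ _))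
Sr≋ r (suc n) (suc k) = TR.trans (T.⊞-cong (Sr≋ r n k)
    (TR.trans (⊛≋⊠ (qint 1 (r * suc k + 1)) (Sr r n (suc k)))
      (TR.trans (T.⊠-cong (qint≋ 1 (r * suc k + 1)) (Sr≋ r n (suc k))) (T.monomial-⊠-constant 0 _ _))))
  (T.monomial-⊞ 0 _ _)

geomInvs : ℕ → ℕ → ℕ → T.PS
geomInvs r s zero = geomInv (r * s)
geomInvs r s (suc k) = geomInv (r * s) T.⊠ geomInvs r (suc s) k

invP≋geomInvs : ∀ r k → invP r k T.≋ geomInvs r 0 k
invP≋geomInvs r k = TR.trans (prodS≋Π (suc k) _) (Π≋geomInvs k 0)
  where
  Π≋geomInvs : ∀ k s → TΣ.Π (suc k) (λ i → geomInv (r * (s + i))) T.≋ geomInvs r s k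
  Π≋geomInvs zero s = TR.trans (TR.*-identityˡ _) (λ a b → ≡.cong (λ e → geomInv (r * e) a b) (ℕ.+-identityʳ s))
  Π≋geomInvs (suc k) s = TR.trans (TΣ.Π-unfoldˡ (suc k) _)
    (T.⊠-cong (λ a b → ≡.cong (λ e → geomInv (r * e) a b) (ℕ.+-identityʳ s))
      (TR.trans (TΣ.Π-cong (suc k) (λ i a b → ≡.cong (λ e → geomInv (r * e) a b) (ℕ.+-suc s i)))
                (Π≋geomInvs k (suc s))))

-- h_m(1, q^r, …, q^{rk}), the coefficient of t^m in Π_{i=0}^{k} 1/(1 - t q^{ri})
completeHom : ℕ → ℕ → ℕ → Q.PS
completeHom r k m = geomInvs r 0 k m

geomInvs-shift : ∀ r k s j → geomInvs r s k j Q.≋ q^ (r * s * j) Q.⊠ completeHom r k j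
geomInvs-shift r zero s j =
  QR.sym (QR.trans (Q.⊠-congˡ (q^ (r * s * j)) (q^-≡ (≡.cong (_* j) (ℕ.*-zeroʳ r)))) (QR.*-identityʳ _))
geomInvs-shift r (suc k) s j = begin
  QΣ.Σ (suc j) (λ i → q^ (r * s * i) Q.⊠ geomInvs r (suc s) k (j ∸ i))
    ≈⟨ QΣ.Σ-cong-< (suc j) (λ i i<1+j →
         QR.trans (Q.⊠-congˡ (q^ (r * s * i)) (geomInvs-shift r k (suc s) (j ∸ i)))
           (QR.trans (q^-merge (completeHom r k (j ∸ i)) ≡.refl)
             (QR.sym (q^-merge (completeHom r k (j ∸ i)) (exponents i (ℕ.≤-pred i<1+j)))))) ⟩
  QΣ.Σ (suc j) (λ i → q^ (r * s * j) Q.⊠ (q^ (r * (j ∸ i)) Q.⊠ completeHom r k (j ∸ i)))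
    ≈⟨ QΣ.*-distribˡ-Σ (suc j) (q^ (r * s * j)) _ ⟨
  q^ (r * s * j) Q.⊠ QΣ.Σ (suc j) (λ i → q^ (r * (j ∸ i)) Q.⊠ completeHom r k (j ∸ i))
    ≈⟨ Q.⊠-congˡ (q^ (r * s * j)) (QΣ.Σ-cong (suc j) (λ i →
         QR.trans (q^-unit (geomInvs r 1 k (j ∸ i)) (≡.cong (_* i) (ℕ.*-zeroʳ r)))
           (QR.trans (geomInvs-shift r k 1 (j ∸ i))
             (Q.⊠-congʳ (completeHom r k (j ∸ i)) (q^-≡ (≡.cong (_* (j ∸ i)) (ℕ.*-identityʳ r))))))) ⟨
  q^ (r * s * j) Q.⊠ QΣ.Σ (suc j) (λ i → q^ (r * 0 * i) Q.⊠ geomInvs r 1 k (j ∸ i)) ∎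
  where
  exponents : ∀ i → i ≤ j → r * s * j + r * (j ∸ i) ≡ r * s * i + r * suc s * (j ∸ i)
  exponents i i≤j with ℕ.m≤n⇒∃[o]m+o≡n i≤j
  ... | o , ≡.refl rewrite ℕ.m+n∸m≡n i o = identity r s i o
    where
    identity : ∀ r s i o → r * s * (i + o) + r * o ≡ r * s * i + r * suc s * o
    identity = solve-∀

completeHom-suc : ∀ r k m → completeHom r (suc k) m Q.≋ QΣ.Σ (suc m) (λ j → q^ (r * j) Q.⊠ completeHom r k j)
completeHom-suc r k m = begin
  QΣ.Σ (suc m) (λ i → q^ (r * 0 * i) Q.⊠ geomInvs r 1 k (m ∸ i))
    ≈⟨ QΣ.Σ-cong (suc m) (λ i → q^-unit (geomInvs r 1 k (m ∸ i)) (≡.cong (_* i) (ℕ.*-zeroʳ r))) ⟩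
  QΣ.Σ (suc m) (λ i → geomInvs r 1 k (m ∸ i))
    ≈⟨ QΣ.Σ-reverse (suc m) _ ⟩
  QΣ.Σ (suc m) (λ i → geomInvs r 1 k (m ∸ (m ∸ i)))
    ≈⟨ QΣ.Σ-cong-< (suc m) (λ i i<1+m →
         QR.trans (QR.reflexive (≡.cong (geomInvs r 1 k) (ℕ.m∸[m∸n]≡n (ℕ.≤-pred i<1+m))))
           (QR.trans (geomInvs-shift r k 1 i)
             (Q.⊠-congʳ (completeHom r k i) (q^-≡ (≡.cong (_* i) (ℕ.*-identityʳ r)))))) ⟩
  QΣ.Σ (suc m) (λ j → q^ (r * j) Q.⊠ completeHom r k j) ∎

qRising : ℕ → ℕ → ℕ → Q.PS
qRising r k m = QΣ.Π k (λ i → qInt r (m + suc i))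

qRising-unfoldˡ : ∀ r k m → qRising r (suc k) m Q.≋ qInt r (suc m) Q.⊠ qRising r k (suc m)
qRising-unfoldˡ r k m = QR.trans (QΣ.Π-unfoldˡ k _)
  (Q.⊠-cong (QR.reflexive (≡.cong (qInt r) (ℕ.+-comm m 1)))
            (QΣ.Π-cong k (λ i → QR.reflexive (≡.cong (qInt r) (ℕ.+-suc m (suc i))))))

qInt-⊠-Σ-qRising : ∀ r k m →
  qInt r (suc k) Q.⊠ QΣ.Σ (suc m) (λ j → q^ (r * j) Q.⊠ qRising r k j) Q.≋ qRising r (suc k) m
qInt-⊠-Σ-qRising r k zero = begin
  qInt r (suc k) Q.⊠ (Q.𝟘 Q.⊞ q^ (r * 0) Q.⊠ qRising r k 0)
    ≈⟨ Q.⊠-congˡ (qInt r (suc k)) (QR.trans (QR.+-identityˡ _) (q^-unit (qRising r k 0) (ℕ.*-zeroʳ r))) ⟩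
  qInt r (suc k) Q.⊠ qRising r k 0
    ≈⟨ Q.⊠-comm (qInt r (suc k)) (qRising r k 0) ⟩
  qRising r k 0 Q.⊠ qInt r (suc k) ∎
qInt-⊠-Σ-qRising r k (suc m) = begin
  qInt r (suc k) Q.⊠ (QΣ.Σ (suc m) F Q.⊞ q^ (r * suc m) Q.⊠ qRising r k (suc m))
    ≈⟨ QR.distribˡ (qInt r (suc k)) (QΣ.Σ (suc m) F) (q^ (r * suc m) Q.⊠ qRising r k (suc m)) ⟩
  qInt r (suc k) Q.⊠ QΣ.Σ (suc m) F Q.⊞ qInt r (suc k) Q.⊠ (q^ (r * suc m) Q.⊠ qRising r k (suc m))
    ≈⟨ Q.⊞-congʳ (qInt r (suc k) Q.⊠ (q^ (r * suc m) Q.⊠ qRising r k (suc m))) (QR.trans (qInt-⊠-Σ-qRising r k m) (qRising-unfoldˡ r k m)) ⟩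
  qInt r (suc m) Q.⊠ qRising r k (suc m) Q.⊞ qInt r (suc k) Q.⊠ (q^ (r * suc m) Q.⊠ qRising r k (suc m))
    ≈⟨ solve 4 (λ a b c d → a :* d :+ b :* (c :* d) := (a :+ c :* b) :* d) QR.refl
         (qInt r (suc m)) (qInt r (suc k)) (q^ (r * suc m)) (qRising r k (suc m)) ⟩
  (qInt r (suc m) Q.⊞ q^ (r * suc m) Q.⊠ qInt r (suc k)) Q.⊠ qRising r k (suc m)
    ≈⟨ Q.⊠-congʳ (qRising r k (suc m)) (qInt-split r (suc m) (suc k)) ⟨
  qInt r (suc m + suc k) Q.⊠ qRising r k (suc m)
    ≈⟨ Q.⊠-comm (qInt r (suc m + suc k)) (qRising r k (suc m)) ⟩
  qRising r k (suc m) Q.⊠ qInt r (suc m + suc k) ∎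
  where
  F : ℕ → Q.PS
  F j = q^ (r * j) Q.⊠ qRising r k j
  open import Algebra.Solver.Ring.NaturalCoefficients.Default Q.PS-commutativeSemiring

-- h_m(1, q^r, …, q^{rk}) is thus the Gaussian binomial coefficient [m+k choose k]_{q^r}
qFact-⊠-completeHom : ∀ r k m → qFact r k Q.⊠ completeHom r k m Q.≋ qRising r k m
qFact-⊠-completeHom r zero m = QR.trans (Q.⊠-identityˡ _) (q^-≡ (≡.cong (_* m) (ℕ.*-zeroʳ r)))
qFact-⊠-completeHom r (suc k) m = begin
  (qFact r k Q.⊠ qInt r (suc k)) Q.⊠ completeHom r (suc k) m
    ≈⟨ Q.⊠-congˡ (qFact r k Q.⊠ qInt r (suc k)) (completeHom-suc r k m) ⟩
  (qFact r k Q.⊠ qInt r (suc k)) Q.⊠ QΣ.Σ (suc m) (λ j → q^ (r * j) Q.⊠ completeHom r k j)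
    ≈⟨ QΣ.*-distribˡ-Σ (suc m) (qFact r k Q.⊠ qInt r (suc k)) (λ j → q^ (r * j) Q.⊠ completeHom r k j) ⟩
  QΣ.Σ (suc m) (λ j → (qFact r k Q.⊠ qInt r (suc k)) Q.⊠ (q^ (r * j) Q.⊠ completeHom r k j))
    ≈⟨ QΣ.Σ-cong (suc m) (λ j → QR.trans
         (solve 4 (λ a b c d → (a :* b) :* (c :* d) := b :* (c :* (a :* d))) QR.refl
                (qFact r k) (qInt r (suc k)) (q^ (r * j)) (completeHom r k j))
         (Q.⊠-congˡ (qInt r (suc k)) (Q.⊠-congˡ (q^ (r * j)) (qFact-⊠-completeHom r k j)))) ⟩
  QΣ.Σ (suc m) (λ j → qInt r (suc k) Q.⊠ (q^ (r * j) Q.⊠ qRising r k j))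
    ≈⟨ QΣ.*-distribˡ-Σ (suc m) (qInt r (suc k)) _ ⟨
  qInt r (suc k) Q.⊠ QΣ.Σ (suc m) (λ j → q^ (r * j) Q.⊠ qRising r k j)
    ≈⟨ qInt-⊠-Σ-qRising r k m ⟩
  qRising r (suc k) m ∎
  where open import Algebra.Solver.Ring.NaturalCoefficients.Default Q.PS-commutativeSemiring

Stirling-suc-zero : ∀ r n → Stirling r (suc n) 0 Q.≋ Stirling r n 0
Stirling-suc-zero r n = QR.trans (Q.⊠-congʳ (Stirling r n 0) qInt-1) (Q.⊠-identityˡ _)

Stirling-vanish : ∀ r n k → n < k → Stirling r n k Q.≋ Q.𝟘
Stirling-vanish r zero (suc k) _ = QR.refl
Stirling-vanish r (suc n) (suc k) (s≤s n<k) = QR.trans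
  (QR.+-cong (Stirling-vanish r n k n<k)
             (QR.trans (Q.⊠-congˡ (qInt 1 (r * suc k + 1)) (Stirling-vanish r n (suc k) (ℕ.m<n⇒m<1+n n<k)))
                       (QR.zeroʳ (qInt 1 (r * suc k + 1)))))
  (QR.+-identityˡ Q.𝟘)

module RightHandSide (r : ℕ) where

  [r] : Q.PS
  [r] = qInt 1 r

  rhsConst : ℕ → Q.PS
  rhsConst k = q^ (expo r k) Q.⊠ (pow k [r] Q.⊠ qFact r k)

  opaque
    rhsCoeff : ℕ → ℕ → Q.PS
    rhsCoeff k = T.monomial k (rhsConst k) T.⊠ geomInvs r 0 k

    rhsCoeff-+ : ∀ k m → rhsCoeff k (k + m) Q.≋ q^ (expo r k) Q.⊠ (pow k [r] Q.⊠ qRising r k m)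
    rhsCoeff-+ k m = begin
      rhsCoeff k (k + m)
        ≈⟨ T.monomial-⊠-+ k (rhsConst k) (geomInvs r 0 k) m ⟩
      (q^ e Q.⊠ (pow k [r] Q.⊠ qFact r k)) Q.⊠ completeHom r k m
        ≈⟨ Q.⊠-assoc (q^ e) (pow k [r] Q.⊠ qFact r k) (completeHom r k m) ⟩
      q^ e Q.⊠ ((pow k [r] Q.⊠ qFact r k) Q.⊠ completeHom r k m)
        ≈⟨ Q.⊠-congˡ (q^ e) (QR.trans (Q.⊠-assoc (pow k [r]) (qFact r k) (completeHom r k m))
             (Q.⊠-congˡ (pow k [r]) (qFact-⊠-completeHom r k m))) ⟩
      q^ e Q.⊠ (pow k [r] Q.⊠ qRising r k m) ∎
      where
      e : ℕ
      e = expo r k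

    rhsCoeff-< : ∀ k a → a < k → rhsCoeff k a Q.≋ Q.𝟘
    rhsCoeff-< k a = T.monomial-⊠-< k (rhsConst k) (geomInvs r 0 k) a

    rhsCoeff-def : ∀ k → rhsCoeff k T.≋ T.monomial k (rhsConst k) T.⊠ geomInvs r 0 k
    rhsCoeff-def k = TR.refl

  rhsCoeff-≡ : ∀ k {a b} → a ≡ b → rhsCoeff k a Q.≋ rhsCoeff k b
  rhsCoeff-≡ k ≡.refl = QR.refl

  ⊠-rhsCoeff-< : ∀ x k a → a < k → x Q.⊠ rhsCoeff k a Q.≋ Q.𝟘
  ⊠-rhsCoeff-< x k a a<k = QR.trans (Q.⊠-congˡ x (rhsCoeff-< k a a<k)) (QR.zeroʳ x)

  -- For a = k + 1 + m this is [r(k+1+m)+1]_q = [rk+1]_q + q^{rk+1} [r]_q [m+1]_{q^r}.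
  qInt-⊠-rhsCoeff : ∀ k a →
    qInt 1 (r * a + 1) Q.⊠ rhsCoeff k a Q.≋ qInt 1 (r * k + 1) Q.⊠ rhsCoeff k a Q.⊞ rhsCoeff (suc k) a
  qInt-⊠-rhsCoeff k a with ℕ.<-cmp k a
  ... | tri> _ _ a<k = QR.trans (⊠-rhsCoeff-< (qInt 1 (r * a + 1)) k a a<k)
    (QR.sym (QR.trans (QR.+-cong (⊠-rhsCoeff-< (qInt 1 (r * k + 1)) k a a<k)
                                 (rhsCoeff-< (suc k) a (ℕ.m<n⇒m<1+n a<k)))
                      (QR.+-identityˡ Q.𝟘)))
  ... | tri≈ _ ≡.refl _ = QR.sym (QR.trans (Q.⊞-congˡ (qInt 1 (r * k + 1) Q.⊠ rhsCoeff k k) (rhsCoeff-< (suc k) k ℕ.≤-refl))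
                                           (QR.+-identityʳ _))
  ... | tri< k<a _ _ with ℕ.m≤n⇒∃[o]m+o≡n k<a
  ...   | m , ≡.refl = begin
    qInt 1 (r * (suc k + m) + 1) Q.⊠ rhsCoeff k (suc k + m)
      ≈⟨ Q.⊠-cong (QR.trans (qInt-≡ (exponent r k m)) (qInt-split 1 (r * k + 1) (r * suc m))) Zₖ ⟩
    (qInt 1 (r * k + 1) Q.⊞ q^ (1 * (r * k + 1)) Q.⊠ qInt 1 (r * suc m)) Q.⊠ Y
      ≈⟨ Q.⊠-congʳ Y (Q.⊞-congˡ (qInt 1 (r * k + 1)) (Q.⊠-cong (q^-≡ (ℕ.*-identityˡ (r * k + 1))) (qInt-blocks r (suc m)))) ⟩
    (qInt 1 (r * k + 1) Q.⊞ q^ (r * k + 1) Q.⊠ ([r] Q.⊠ qInt r (suc m))) Q.⊠ Y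
      ≈⟨ QR.distribʳ Y (qInt 1 (r * k + 1)) (q^ (r * k + 1) Q.⊠ ([r] Q.⊠ qInt r (suc m))) ⟩
    qInt 1 (r * k + 1) Q.⊠ Y Q.⊞ (q^ (r * k + 1) Q.⊠ ([r] Q.⊠ qInt r (suc m))) Q.⊠ Y
      ≈⟨ QR.+-cong (Q.⊠-congˡ (qInt 1 (r * k + 1)) (QR.sym Zₖ)) Zₖ₊₁ ⟩
    qInt 1 (r * k + 1) Q.⊠ rhsCoeff k (suc k + m) Q.⊞ rhsCoeff (suc k) (suc k + m) ∎
    where
    open import Algebra.Solver.Ring.NaturalCoefficients.Default Q.PS-commutativeSemiring
    e : ℕ
    e = expo r k
    Y : Q.PS
    Y = q^ e Q.⊠ (pow k [r] Q.⊠ qRising r k (suc m))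
    Zₖ : rhsCoeff k (suc k + m) Q.≋ Y
    Zₖ = QR.trans (rhsCoeff-≡ k (≡.sym (ℕ.+-suc k m))) (rhsCoeff-+ k (suc m))
    Zₖ₊₁ : (q^ (r * k + 1) Q.⊠ ([r] Q.⊠ qInt r (suc m))) Q.⊠ Y Q.≋ rhsCoeff (suc k) (suc k + m)
    Zₖ₊₁ = begin
      (q^ (r * k + 1) Q.⊠ ([r] Q.⊠ qInt r (suc m))) Q.⊠ (q^ e Q.⊠ (pow k [r] Q.⊠ qRising r k (suc m)))
        ≈⟨ solve 6 (λ b x y z u v → (b :* (x :* y)) :* (z :* (u :* v)) := (z :* b) :* ((u :* x) :* (y :* v))) QR.refl
             (q^ (r * k + 1)) [r] (qInt r (suc m)) (q^ e) (pow k [r]) (qRising r k (suc m)) ⟩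
      (q^ e Q.⊠ q^ (r * k + 1)) Q.⊠ (pow (suc k) [r] Q.⊠ (qInt r (suc m) Q.⊠ qRising r k (suc m)))
        ≈⟨ Q.⊠-cong (QR.trans (q^-+ e (r * k + 1)) (q^-≡ (≡.sym (expo-suc r k))))
                    (Q.⊠-congˡ (pow (suc k) [r]) (QR.sym (qRising-unfoldˡ r k m))) ⟩
      q^ (expo r (suc k)) Q.⊠ (pow (suc k) [r] Q.⊠ qRising r (suc k) m)
        ≈⟨ rhsCoeff-+ (suc k) m ⟨
      rhsCoeff (suc k) (suc k + m) ∎
    qInt-≡ : ∀ {x y} → x ≡ y → qInt 1 x Q.≋ qInt 1 y
    qInt-≡ ≡.refl = QR.refl
    exponent : ∀ r k m → r * (suc k + m) + 1 ≡ (r * k + 1) + r * suc m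
    exponent = solve-∀

  Σ-Stirling-rhsCoeff : ∀ n a →
    QΣ.Σ (suc n) (λ k → Stirling r n k Q.⊠ rhsCoeff k a) Q.≋ pow n (qInt 1 (r * a + 1))
  Σ-Stirling-rhsCoeff zero a = begin
    Q.𝟘 Q.⊞ Q.𝟙 Q.⊠ rhsCoeff 0 a                ≈⟨ QR.trans (QR.+-identityˡ _) (Q.⊠-identityˡ _) ⟩
    rhsCoeff 0 a                                 ≈⟨ rhsCoeff-+ 0 a ⟩
    q^ (expo r 0) Q.⊠ (Q.𝟙 Q.⊠ Q.𝟙)              ≈⟨ q^-unit (Q.𝟙 Q.⊠ Q.𝟙) (expo-zero r) ⟩
    Q.𝟙 Q.⊠ Q.𝟙                                  ≈⟨ Q.⊠-identityˡ Q.𝟙 ⟩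
    Q.𝟙                                          ∎
  Σ-Stirling-rhsCoeff (suc n) a = begin
    QΣ.Σ (suc (suc n)) (λ k → S′ k Q.⊠ Z k)
      ≈⟨ QΣ.Σ-unfoldˡ (suc n) (λ k → S′ k Q.⊠ Z k) ⟩
    S′ 0 Q.⊠ Z 0 Q.⊞ QΣ.Σ (suc n) (λ k → S′ (suc k) Q.⊠ Z (suc k))
      ≈⟨ QR.+-cong head (QΣ.Σ-cong (suc n) step) ⟩
    G 0 Q.⊞ QΣ.Σ (suc n) (λ k → G (suc k) Q.⊞ S k Q.⊠ Z (suc k))
      ≈⟨ Q.⊞-congˡ (G 0) (QΣ.Σ-distrib-+ (suc n) (λ k → G (suc k)) (λ k → S k Q.⊠ Z (suc k))) ⟩
    G 0 Q.⊞ (QΣ.Σ (suc n) (λ k → G (suc k)) Q.⊞ QΣ.Σ (suc n) (λ k → S k Q.⊠ Z (suc k)))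
      ≈⟨ QR.trans (QR.sym (QR.+-assoc (G 0) (QΣ.Σ (suc n) (λ k → G (suc k))) T′))
                  (Q.⊞-congʳ T′ (QR.sym (QΣ.Σ-unfoldˡ (suc n) G))) ⟩
    (QΣ.Σ (suc n) G Q.⊞ G (suc n)) Q.⊞ QΣ.Σ (suc n) (λ k → S k Q.⊠ Z (suc k))
      ≈⟨ Q.⊞-congʳ T′ (QR.trans (Q.⊞-congˡ (QΣ.Σ (suc n) G) top) (QR.+-identityʳ _)) ⟩
    QΣ.Σ (suc n) G Q.⊞ QΣ.Σ (suc n) (λ k → S k Q.⊠ Z (suc k))
      ≈⟨ QΣ.Σ-distrib-+ (suc n) G (λ k → S k Q.⊠ Z (suc k)) ⟨
    QΣ.Σ (suc n) (λ k → G k Q.⊞ S k Q.⊠ Z (suc k))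
      ≈⟨ QΣ.Σ-cong (suc n) merge ⟩
    QΣ.Σ (suc n) (λ k → u Q.⊠ (S k Q.⊠ Z k))
      ≈⟨ QΣ.*-distribˡ-Σ (suc n) u (λ k → S k Q.⊠ Z k) ⟨
    u Q.⊠ QΣ.Σ (suc n) (λ k → S k Q.⊠ Z k)
      ≈⟨ Q.⊠-congˡ u (Σ-Stirling-rhsCoeff n a) ⟩
    u Q.⊠ pow n u
      ≈⟨ Q.⊠-comm u (pow n u) ⟩
    pow (suc n) u ∎
    where
    open import Algebra.Solver.Ring.NaturalCoefficients.Default Q.PS-commutativeSemiring
    u : Q.PS
    u = qInt 1 (r * a + 1)
    S S′ : ℕ → Q.PS
    S = Stirling r n
    S′ = Stirling r (suc n)
    Z : ℕ → Q.PS
    Z k = rhsCoeff k a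
    G : ℕ → Q.PS
    G k = qInt 1 (r * k + 1) Q.⊠ (S k Q.⊠ Z k)
    T′ : Q.PS
    T′ = QΣ.Σ (suc n) (λ k → S k Q.⊠ Z (suc k))
    head : S′ 0 Q.⊠ Z 0 Q.≋ G 0
    head = QR.trans (Q.⊠-congʳ (Z 0) (Stirling-suc-zero r n))
      (QR.sym (QR.trans (Q.⊠-congʳ (S 0 Q.⊠ Z 0) (QR.trans (λ b → ≡.cong (λ x → qInt 1 (x + 1) b) (ℕ.*-zeroʳ r)) qInt-1))
                        (Q.⊠-identityˡ (S 0 Q.⊠ Z 0))))
    step : ∀ k → S′ (suc k) Q.⊠ Z (suc k) Q.≋ G (suc k) Q.⊞ S k Q.⊠ Z (suc k)
    step k = solve 4 (λ s x s′ z → (s :+ x :* s′) :* z := x :* (s′ :* z) :+ s :* z) QR.refl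
               (S k) (qInt 1 (r * suc k + 1)) (S (suc k)) (Z (suc k))
    top : G (suc n) Q.≋ Q.𝟘
    top = QR.trans (Q.⊠-congˡ (qInt 1 (r * suc n + 1))
                     (QR.trans (Q.⊠-congʳ (Z (suc n)) (Stirling-vanish r n (suc n) ℕ.≤-refl)) (Q.⊠-zeroˡ (Z (suc n)))))
                   (QR.zeroʳ (qInt 1 (r * suc n + 1)))
    merge : ∀ k → G k Q.⊞ S k Q.⊠ Z (suc k) Q.≋ u Q.⊠ (S k Q.⊠ Z k)
    merge k = begin
      G k Q.⊞ S k Q.⊠ Z (suc k)
        ≈⟨ solve 4 (λ x s z z′ → x :* (s :* z) :+ s :* z′ := s :* (x :* z :+ z′)) QR.refl
             (qInt 1 (r * k + 1)) (S k) (Z k) (Z (suc k)) ⟩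
      S k Q.⊠ (qInt 1 (r * k + 1) Q.⊠ Z k Q.⊞ Z (suc k))
        ≈⟨ Q.⊠-congˡ (S k) (qInt-⊠-rhsCoeff k a) ⟨
      S k Q.⊠ (u Q.⊠ Z k)
        ≈⟨ solve 3 (λ s x z → s :* (x :* z) := x :* (s :* z)) QR.refl (S k) u (Z k) ⟩
      u Q.⊠ (S k Q.⊠ Z k) ∎

  rhsTerm≋ : ∀ n k → rhsTerm r n k T.≋ T.monomial 0 (Stirling r n k) T.⊠ (T.monomial k (rhsConst k) T.⊠ geomInvs r 0 k)
  rhsTerm≋ n k =
    TR.trans (⊛≋⊠ (mono k (expo r k) ⊛ powS k (qint 1 r) ⊛ qfact r k ⊛ Sr r n k) (invP r k))
    (TR.trans (T.⊠-cong numerator (invP≋geomInvs r k))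
    (TR.trans (T.⊠-congʳ (geomInvs r 0 k) (T.monomial-cong k (solve 4
                 (λ x y z s → x :* y :* z :* s := s :* (x :* (y :* z))) QR.refl
                 (q^ (expo r k)) (pow k [r]) (qFact r k) (Stirling r n k))))
    (TR.trans (T.⊠-congʳ (geomInvs r 0 k) (TR.sym (T.monomial-⊠-monomial 0 (Stirling r n k) k (rhsConst k))))
              (T.⊠-assoc (T.monomial 0 (Stirling r n k)) (T.monomial k (rhsConst k)) (geomInvs r 0 k)))))
    where
    open import Algebra.Solver.Ring.NaturalCoefficients.Default Q.PS-commutativeSemiring
    ⊛-constant : ∀ {f g i x y} → f T.≋ T.monomial i x → g T.≋ T.monomial 0 y → f ⊛ g T.≋ T.monomial i (x Q.⊠ y)
    ⊛-constant {f} {g} {i} {x} {y} f≋ g≋ =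
      TR.trans (⊛≋⊠ f g) (TR.trans (T.⊠-cong f≋ g≋) (T.monomial-⊠-constant i x y))
    numerator : mono k (expo r k) ⊛ powS k (qint 1 r) ⊛ qfact r k ⊛ Sr r n k
                  T.≋ T.monomial k (q^ (expo r k) Q.⊠ pow k [r] Q.⊠ qFact r k Q.⊠ Stirling r n k)
    numerator = ⊛-constant (⊛-constant (⊛-constant (mono≋monomial k (expo r k)) (powS≋ k (qint≋ 1 r)))
                                       (qfact≋ r k))
                           (Sr≋ r n k)

  rhs-coefficient : ∀ n a → sumS (suc n) (rhsTerm r n) a Q.≋ pow n (qInt 1 (r * a + 1))
  rhs-coefficient n a = begin
    sumS (suc n) (rhsTerm r n) a
      ≈⟨ QR.trans (sumS≋Σ (suc n) (rhsTerm r n) a) (Σ-apply (suc n) (rhsTerm r n) a) ⟩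
    QΣ.Σ (suc n) (λ k → rhsTerm r n k a)
      ≈⟨ QΣ.Σ-cong (suc n) (λ k → QR.trans (rhsTerm≋ n k a)
           (QR.trans (T.monomial-⊠-+ 0 (Stirling r n k) (T.monomial k (rhsConst k) T.⊠ geomInvs r 0 k) a)
                     (Q.⊠-congˡ (Stirling r n k) (QR.sym (rhsCoeff-def k a))))) ⟩
    QΣ.Σ (suc n) (λ k → Stirling r n k Q.⊠ rhsCoeff k a)
      ≈⟨ Σ-Stirling-rhsCoeff n a ⟩
    pow n (qInt 1 (r * a + 1)) ∎

-- The left-hand side

module BarredLetters (r N : ℕ) where
  open Coding r N
  open MaximumDecomposition Q.PS-commutativeSemiring

  weight : ℕ → ℕ → Q.PS
  weight l c = q^ (r * l + c)

  module C (L : ℕ) = Choices r L code weight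

  -- Π_{v ∈ vs} Σ q^{r l + c} over the barred letters (l, v^c), l < L, lying weakly below (a, p)
  barredProduct : ℕ → List ℕ → Letter → ℕ → Q.PS
  barredProduct L vs p a = QΣ.ΠL (λ v → C.below L v (suc (a * width + corank p))) vs

  Injective-code : ∀ L vs → All (_< N) vs → C.Injective L vs
  Injective-code L vs vs<N {u} {v} {l} {c} {l′} {c′} u∈ v∈ _ c<r _ c′<r eq =
    code-injective u c v c′ l l′ (All.lookup vs<N u∈ , c<r) (All.lookup vs<N v∈ , c′<r) eq

  at-other : ∀ L {u v} → u < N → v < N → u ≢ v → ∀ l c → c < r → C.at L u (code v l c) Q.≋ Q.𝟘
  at-other L {u} {v} u<N v<N u≢v l c c<r = C.ΣΣ-zero L _ (λ l′ c′ _ c′<r →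
    QR.reflexive (≡.cong (λ b → QΣ.when b (weight l′ c′)) (isNo l′ c′ c′<r)))
    where
    isNo : ∀ l′ c′ → c′ < r → ⌊ code u l′ c′ ≟ code v l c ⌋ ≡ false
    isNo l′ c′ c′<r with code u l′ c′ ≟ code v l c
    ... | yes eq = ⊥-elim (u≢v (code-injective u c′ v c l′ l (u<N , c′<r) (v<N , c<r) eq))
    ... | no _ = ≡.refl

  barredProduct-byMaximum : ∀ L vs → Unique vs → All (_< N) vs → ∀ {v₀} → v₀ ∈ vs → ∀ p → Valid p → ∀ a → a < L →
    barredProduct L vs p a Q.≋
      QΣ.ΣL (λ v → QΣ.Σ r (λ c → q^ c Q.⊠ QΣ.Σ (suc a ∸ descent p (v , c))
                                            (λ l → q^ (r * l) Q.⊠ barredProduct L (remove v vs) (v , c) l))) vs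
  barredProduct-byMaximum L vs vs! vs<N v₀∈ p vp a a<L =
    QR.trans (C.ΠL-below L vs vs! (Injective-code L vs vs<N) v₀∈ (suc (a * width + corank p)))
             (QΣ.ΣL-cong vs (λ v v∈ → QR.trans (QΣ.Σ-comm L r _) (QΣ.Σ-cong-< r (λ c c<r → column v v∈ c c<r))))
    where
    column : ∀ v → v ∈ vs → ∀ c → c < r →
      QΣ.Σ L (λ l → QΣ.when ⌊ code v l c <? suc (a * width + corank p) ⌋
                             (weight l c Q.⊠ QΣ.ΠL (λ u → C.below L u (code v l c)) (remove v vs)))
        Q.≋ q^ c Q.⊠ QΣ.Σ (suc a ∸ descent p (v , c)) (λ l → q^ (r * l) Q.⊠ barredProduct L (remove v vs) (v , c) l)
    column v v∈ c c<r = begin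
      QΣ.Σ L (λ l → QΣ.when ⌊ code v l c <? suc (a * width + corank p) ⌋ (Y l))
        ≈⟨ QΣ.Σ-cong L (λ l → QR.reflexive (≡.cong (λ b → QΣ.when b (Y l)) (code-below p (v , c) vp (v<N , c<r) l a))) ⟩
      QΣ.Σ L (λ l → QΣ.when ⌊ l <? M ⌋ (Y l))
        ≈⟨ QΣ.Σ-truncate M L Y (ℕ.≤-trans (ℕ.m∸n≤m (suc a) (descent p (v , c))) a<L) ⟩
      QΣ.Σ M Y
        ≈⟨ QΣ.Σ-cong M Y≈ ⟩
      QΣ.Σ M (λ l → q^ c Q.⊠ (q^ (r * l) Q.⊠ barredProduct L (remove v vs) (v , c) l))
        ≈⟨ QΣ.*-distribˡ-Σ M (q^ c) _ ⟨
      q^ c Q.⊠ QΣ.Σ M (λ l → q^ (r * l) Q.⊠ barredProduct L (remove v vs) (v , c) l) ∎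
      where
      v<N = All.lookup vs<N v∈
      M = suc a ∸ descent p (v , c)
      Y : ℕ → Q.PS
      Y l = weight l c Q.⊠ QΣ.ΠL (λ u → C.below L u (code v l c)) (remove v vs)
      -- no other letter sits at the position of the maximum, so "below or at" it is "below" it
      Y≈ : ∀ l → Y l Q.≋ q^ c Q.⊠ (q^ (r * l) Q.⊠ barredProduct L (remove v vs) (v , c) l)
      Y≈ l = QR.trans
        (Q.⊠-cong (QR.trans (q^-≡ (ℕ.+-comm (r * l) c)) (QR.sym (q^-+ c (r * l))))
                  (QΣ.ΠL-cong (remove v vs) (λ u u∈ → let u∈vs , u≢v = ∈-remove⁻ v vs u∈ in
                     QR.sym (QR.trans (C.below-suc L u (code v l c))
                       (QR.trans (Q.⊞-congˡ _ (at-other L (All.lookup vs<N u∈vs) v<N u≢v l c c<r)) (QR.+-identityʳ _))))))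
        (Q.⊠-assoc (q^ c) (q^ (r * l)) (barredProduct L (remove v vs) (v , c) l))

q^-rearrange : ∀ {x y z u v w} P → x + (y + z) ≡ u + (v + w) →
  (q^ x Q.⊠ P) Q.⊠ (q^ y Q.⊠ q^ z) Q.≋ q^ u Q.⊠ (q^ v Q.⊠ (q^ w Q.⊠ P))
q^-rearrange {x} {y} {z} {u} {v} {w} P eq = begin
  (q^ x Q.⊠ P) Q.⊠ (q^ y Q.⊠ q^ z)  ≈⟨ solve 4 (λ X P Y Z → (X :* P) :* (Y :* Z) := X :* ((Y :* Z) :* P)) QR.refl (q^ x) P (q^ y) (q^ z) ⟩
  q^ x Q.⊠ ((q^ y Q.⊠ q^ z) Q.⊠ P)  ≈⟨ Q.⊠-congˡ (q^ x) (Q.⊠-assoc (q^ y) (q^ z) P) ⟩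
  q^ x Q.⊠ (q^ y Q.⊠ (q^ z Q.⊠ P))  ≈⟨ Q.⊠-congˡ (q^ x) (q^-merge P ≡.refl) ⟩
  q^ x Q.⊠ (q^ (y + z) Q.⊠ P)       ≈⟨ q^-merge P eq ⟩
  q^ (u + (v + w)) Q.⊠ P            ≈⟨ q^-merge P ≡.refl ⟨
  q^ u Q.⊠ (q^ (v + w) Q.⊠ P)       ≈⟨ Q.⊠-congˡ (q^ u) (q^-merge P ≡.refl) ⟨
  q^ u Q.⊠ (q^ v Q.⊠ (q^ w Q.⊠ P))  ∎
  where open import Algebra.Solver.Ring.NaturalCoefficients.Default Q.PS-commutativeSemiring

ΣL-coloured : ∀ r (F : Letter → Q.PS) vs → QΣ.ΣL F (coloured r vs) Q.≋ QΣ.ΣL (λ v → QΣ.Σ r (λ c → F (v , c))) vs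
ΣL-coloured r F [] = QR.refl
ΣL-coloured r F (v ∷ vs) = QR.trans (QΣ.ΣL-++ F (map (v ,_) (upTo r)) (coloured r vs))
                                    (QR.+-cong (row r (λ c → c)) (ΣL-coloured r F vs))
  where
  row : ∀ n (g : ℕ → ℕ) → QΣ.ΣL F (map (v ,_) (applyUpTo g n)) Q.≋ QΣ.Σ n (λ c → F (v , g c))
  row zero g = QR.refl
  row (suc n) g = QR.trans (Q.⊞-congˡ (F (v , g 0)) (row n (λ i → g (suc i))))
                           (QR.sym (QΣ.Σ-unfoldˡ n (λ c → F (v , g c))))

ΠL-const : ∀ {X : Set} u (xs : List X) → QΣ.ΠL (λ _ → u) xs Q.≋ pow (length xs) u
ΠL-const u [] = QR.refl
ΠL-const u (x ∷ xs) = QR.trans (Q.⊠-congˡ u (ΠL-const u xs)) (Q.⊠-comm u (pow (length xs) u))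

module DescentCoefficients (r N : ℕ) where
  open Coding r N
  open BarredLetters r N

  stepFactor : ℕ → ℕ → ℕ → T.PS
  stepFactor i e f = mono i e T.⊠ geomInv f

  stepFactor-+ : ∀ i e f k → stepFactor i e f (i + k) Q.≋ q^ e Q.⊠ q^ (f * k)
  stepFactor-+ i e f k = QR.trans (T.⊠-congʳ (geomInv f) (mono≋monomial i e) (i + k)) (T.monomial-⊠-+ i (q^ e) (geomInv f) k)

  stepFactor-< : ∀ i e f k → k < i → stepFactor i e f k Q.≋ Q.𝟘
  stepFactor-< i e f k k<i = QR.trans (T.⊠-congʳ (geomInv f) (mono≋monomial i e) k) (T.monomial-⊠-< i (q^ e) (geomInv f) k k<i)

  -- the effect on coefficients of the first letter's factor t^δ q^{rsδ + c} and of 1/(1 - t q^{rs})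
  coefficient-step : ∀ s a c (K : T.PS) (P : ℕ → Q.PS) → (∀ a′ → a′ ≤ a → K a′ Q.≋ q^ (r * suc s * a′) Q.⊠ P a′) → ∀ b →
    (K T.⊠ stepFactor (bit b) (r * s * bit b + c) (r * s)) a
      Q.≋ q^ (r * s * a) Q.⊠ (q^ c Q.⊠ QΣ.Σ (suc a ∸ bit b) (λ l → q^ (r * l) Q.⊠ P l))
  coefficient-step s a c K P K≈ false = begin
    QΣ.Σ (suc a) (λ a′ → K a′ Q.⊠ stepFactor 0 e (r * s) (a ∸ a′))
      ≈⟨ QΣ.Σ-cong-< (suc a) (λ a′ a′<1+a → term a′ (ℕ.≤-pred a′<1+a)) ⟩
    QΣ.Σ (suc a) (λ a′ → q^ (r * s * a) Q.⊠ (q^ c Q.⊠ Z a′))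
      ≈⟨ QΣ.*-distribˡ-Σ (suc a) (q^ (r * s * a)) _ ⟨
    q^ (r * s * a) Q.⊠ QΣ.Σ (suc a) (λ a′ → q^ c Q.⊠ Z a′)
      ≈⟨ Q.⊠-congˡ (q^ (r * s * a)) (QΣ.*-distribˡ-Σ (suc a) (q^ c) Z) ⟨
    q^ (r * s * a) Q.⊠ (q^ c Q.⊠ QΣ.Σ (suc a) Z) ∎
    where
    e = r * s * 0 + c
    Z : ℕ → Q.PS
    Z l = q^ (r * l) Q.⊠ P l
    term : ∀ a′ → a′ ≤ a → K a′ Q.⊠ stepFactor 0 e (r * s) (a ∸ a′) Q.≋ q^ (r * s * a) Q.⊠ (q^ c Q.⊠ Z a′)
    term a′ a′≤a with ℕ.m≤n⇒∃[o]m+o≡n a′≤a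
    ... | k , ≡.refl = QR.trans
      (Q.⊠-cong (K≈ a′ a′≤a) (QR.trans (stepFactor-+ 0 e (r * s) (a′ + k ∸ a′))
                                      (Q.⊠-congˡ (q^ e) (q^-≡ (≡.cong (r * s *_) (ℕ.m+n∸m≡n a′ k))))))
      (q^-rearrange (P a′) (exponents r s a′ k c))
      where
      exponents : ∀ r s a′ k c → r * suc s * a′ + ((r * s * 0 + c) + r * s * k) ≡ r * s * (a′ + k) + (c + r * a′)
      exponents = solve-∀
  coefficient-step s a c K P K≈ true = begin
    QΣ.Σ a (λ a′ → K a′ Q.⊠ stepFactor 1 e (r * s) (a ∸ a′)) Q.⊞ K a Q.⊠ stepFactor 1 e (r * s) (a ∸ a)
      ≈⟨ QR.+-cong (QΣ.Σ-cong-< a term) last ⟩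
    QΣ.Σ a (λ a′ → q^ (r * s * a) Q.⊠ (q^ c Q.⊠ Z a′)) Q.⊞ Q.𝟘
      ≈⟨ QR.+-identityʳ _ ⟩
    QΣ.Σ a (λ a′ → q^ (r * s * a) Q.⊠ (q^ c Q.⊠ Z a′))
      ≈⟨ QΣ.*-distribˡ-Σ a (q^ (r * s * a)) _ ⟨
    q^ (r * s * a) Q.⊠ QΣ.Σ a (λ a′ → q^ c Q.⊠ Z a′)
      ≈⟨ Q.⊠-congˡ (q^ (r * s * a)) (QΣ.*-distribˡ-Σ a (q^ c) Z) ⟨
    q^ (r * s * a) Q.⊠ (q^ c Q.⊠ QΣ.Σ a Z) ∎
    where
    e = r * s * 1 + c
    Z : ℕ → Q.PS
    Z l = q^ (r * l) Q.⊠ P l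
    last : K a Q.⊠ stepFactor 1 e (r * s) (a ∸ a) Q.≋ Q.𝟘
    last = QR.trans (Q.⊠-congˡ (K a) (QR.trans (QR.reflexive (≡.cong (stepFactor 1 e (r * s)) (ℕ.n∸n≡0 a)))
                                               (stepFactor-< 1 e (r * s) 0 (s≤s z≤n))))
                    (QR.zeroʳ (K a))
    term : ∀ a′ → a′ < a → K a′ Q.⊠ stepFactor 1 e (r * s) (a ∸ a′) Q.≋ q^ (r * s * a) Q.⊠ (q^ c Q.⊠ Z a′)
    term a′ a′<a with ℕ.m≤n⇒∃[o]m+o≡n a′<a
    ... | k , ≡.refl = QR.trans
      (Q.⊠-cong (K≈ a′ (ℕ.<⇒≤ a′<a)) (QR.trans (QR.reflexive (≡.cong (stepFactor 1 e (r * s)) (gap a′ k)))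
                                               (stepFactor-+ 1 e (r * s) k)))
      (q^-rearrange (P a′) (exponents r s a′ k c))
      where
      gap : ∀ a′ k → suc a′ + k ∸ a′ ≡ suc k
      gap a′ k = ≡.trans (≡.cong (_∸ a′) (≡.sym (ℕ.+-suc a′ k))) (ℕ.m+n∸m≡n a′ (suc k))
      exponents : ∀ r s a′ k c → r * suc s * a′ + ((r * s * 1 + c) + r * s * k) ≡ r * s * (suc a′ + k) + (c + r * a′)
      exponents = solve-∀

  -- Peeling off the first letter of the words matches splitting off the largest barred letter.
  descGF-coefficient : ∀ L m vs → length vs ≡ m → Unique vs → All (_< N) vs → ∀ p → Valid p → ∀ s a → a < L →
    (descGF r m vs p s T.⊠ geomInvs r s m) a Q.≋ q^ (r * s * a) Q.⊠ barredProduct L vs p a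
  descGF-coefficient L zero [] _ _ _ p vp s a a<L = begin
    (descGF r 0 [] p s T.⊠ geomInv (r * s)) a
      ≈⟨ T.⊠-congʳ (geomInv (r * s)) (TR.trans (TR.+-identityʳ _) (mono-≡ ≡.refl (≡.trans (ℕ.+-identityʳ (r * 0)) (ℕ.*-zeroʳ r)))) a ⟩
    stepFactor 0 0 (r * s) a
      ≈⟨ stepFactor-+ 0 0 (r * s) a ⟩
    q^ 0 Q.⊠ q^ (r * s * a)
      ≈⟨ Q.⊠-identityˡ _ ⟩
    q^ (r * s * a)
      ≈⟨ QR.*-identityʳ _ ⟨
    q^ (r * s * a) Q.⊠ Q.𝟙 ∎
  descGF-coefficient L (suc m) vs@(v₀ ∷ _) len vs! vs<N p vp s a a<L = begin
    (descGF r (suc m) vs p s T.⊠ (g T.⊠ H)) a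
      ≈⟨ by-first-letter a ⟩
    TΣ.ΣL (λ x → (G x T.⊠ H) T.⊠ (first x T.⊠ g)) (coloured r vs) a
      ≈⟨ ΣL-apply _ (coloured r vs) a ⟩
    QΣ.ΣL (λ x → ((G x T.⊠ H) T.⊠ (first x T.⊠ g)) a) (coloured r vs)
      ≈⟨ ΣL-coloured r _ vs ⟩
    QΣ.ΣL (λ v → QΣ.Σ r (λ c → ((G (v , c) T.⊠ H) T.⊠ (first (v , c) T.⊠ g)) a)) vs
      ≈⟨ QΣ.ΣL-cong vs (λ v v∈ → QΣ.Σ-cong-< r (λ c c<r → cell v v∈ c c<r)) ⟩
    QΣ.ΣL (λ v → QΣ.Σ r (λ c → q^ (r * s * a) Q.⊠ X v c)) vs
      ≈⟨ QΣ.ΣL-cong vs (λ v _ → QΣ.*-distribˡ-Σ r (q^ (r * s * a)) (X v)) ⟨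
    QΣ.ΣL (λ v → q^ (r * s * a) Q.⊠ QΣ.Σ r (X v)) vs
      ≈⟨ QΣ.*-distribˡ-ΣL (q^ (r * s * a)) (λ v → QΣ.Σ r (X v)) vs ⟨
    q^ (r * s * a) Q.⊠ QΣ.ΣL (λ v → QΣ.Σ r (X v)) vs
      ≈⟨ Q.⊠-congˡ (q^ (r * s * a)) (barredProduct-byMaximum L vs vs! vs<N (here ≡.refl) p vp a a<L) ⟨
    q^ (r * s * a) Q.⊠ barredProduct L vs p a ∎
    where
    g = geomInv (r * s)
    H = geomInvs r (suc s) m
    first : Letter → T.PS
    first x = mono (descent p x) (r * s * descent p x + proj₂ x)
    G : Letter → T.PS
    G x = descGF r m (remove (proj₁ x) vs) x (suc s)
    X : ℕ → ℕ → Q.PS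
    X v c = q^ c Q.⊠ QΣ.Σ (suc a ∸ descent p (v , c)) (λ l → q^ (r * l) Q.⊠ barredProduct L (remove v vs) (v , c) l)
    by-first-letter : descGF r (suc m) vs p s T.⊠ (g T.⊠ H) T.≋ TΣ.ΣL (λ x → (G x T.⊠ H) T.⊠ (first x T.⊠ g)) (coloured r vs)
    by-first-letter = TR.trans (T.⊠-congʳ (g T.⊠ H) (descGF-suc r m vs p s))
      (TR.trans (TΣ.*-distribʳ-ΣL _ (coloured r vs) (g T.⊠ H))
      (TΣ.ΣL-cong (coloured r vs) (λ x _ →
        solve 4 (λ f G g H → (f :* G) :* (g :* H) := (G :* H) :* (f :* g)) TR.refl (first x) (G x) g H)))
      where open import Algebra.Solver.Ring.NaturalCoefficients.Default T.PS-commutativeSemiring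
    cell : ∀ v → v ∈ vs → ∀ c → c < r → ((G (v , c) T.⊠ H) T.⊠ (first (v , c) T.⊠ g)) a Q.≋ q^ (r * s * a) Q.⊠ X v c
    cell v v∈ c c<r = coefficient-step s a c (G (v , c) T.⊠ H) (barredProduct L (remove v vs) (v , c))
      (λ a′ a′≤a → descGF-coefficient L m (remove v vs) (length-remove v vs m len vs! v∈) (remove-Unique v vs vs!)
                     (remove-All v vs vs<N) (v , c) (All.lookup vs<N v∈ , c<r) (suc s) a′ (ℕ.≤-<-trans a′≤a a<L))
      (p >ᵇ (v , c))

module LeftHandSide (r n : ℕ) (1≤r : 1 ≤ r) where
  N = suc n
  open Coding r N
  open BarredLetters r N
  open DescentCoefficients r N

  letters : List ℕ
  letters = map suc (upTo n)

  letters≡ : letters ≡ applyUpTo suc n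
  letters≡ = List.map-applyUpTo (λ i → i) suc n

  letters-Unique : Unique letters
  letters-Unique = ≡.subst Unique (≡.sym letters≡)
    (Uniqueₚ.applyUpTo⁺₁ suc n (λ i<j _ eq → ℕ.<⇒≢ i<j (ℕ.suc-injective eq)))

  letters<N : All (_< N) letters
  letters<N = ≡.subst (All (_< N)) (≡.sym letters≡) (Allₚ.applyUpTo⁺₁ suc n s≤s)

  length-letters : length letters ≡ n
  length-letters = ≡.trans (List.length-map suc (upTo n)) (List.length-upTo n)

  Valid-zero : Valid (0 , 0)
  Valid-zero = s≤s z≤n , 1≤r

  below-origin : ∀ a v → v < N → C.below (suc a) v (suc (a * width + corank (0 , 0))) Q.≋ qInt 1 (r * a + 1)
  below-origin a v v<N = begin
    QΣ.Σ (suc a) (λ l → QΣ.Σ r (λ c → QΣ.when ⌊ code v l c <? suc (a * width + corank (0 , 0)) ⌋ (weight l c)))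
      ≈⟨ QΣ.Σ-cong (suc a) (λ l → QΣ.Σ-cong-< r (λ c c<r →
           QR.reflexive (≡.cong (λ b → QΣ.when b (weight l c)) (code-below (0 , 0) (v , c) Valid-zero (v<N , c<r) l a)))) ⟩
    QΣ.Σ (suc a) (λ l → QΣ.Σ r (λ c → QΣ.when ⌊ l <? M c ⌋ (weight l c)))
      ≈⟨ QΣ.Σ-comm (suc a) r _ ⟩
    QΣ.Σ r (λ c → QΣ.Σ (suc a) (λ l → QΣ.when ⌊ l <? M c ⌋ (weight l c)))
      ≈⟨ QΣ.Σ-cong r (λ c → QΣ.Σ-truncate (M c) (suc a) (λ l → weight l c) (ℕ.m∸n≤m (suc a) (descent (0 , 0) (v , c)))) ⟩
    QΣ.Σ r F
      ≈⟨ columns (proj₁ (ℕ.m≤n⇒∃[o]m+o≡n 1≤r)) (≡.sym (proj₂ (ℕ.m≤n⇒∃[o]m+o≡n 1≤r))) ⟩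
    qInt 1 (r * a + 1) ∎
    where
    M : ℕ → ℕ
    M c = suc a ∸ descent (0 , 0) (v , c)
    F : ℕ → Q.PS
    F c = QΣ.Σ (M c) (λ l → weight l c)
    columns : ∀ r′ → r ≡ suc r′ → QΣ.Σ r F Q.≋ qInt 1 (r * a + 1)
    columns r′ r≡ = begin
      QΣ.Σ r F
        ≈⟨ QΣ.Σ-≡ F r≡ ⟩
      QΣ.Σ (suc r′) F
        ≈⟨ QΣ.Σ-unfoldˡ r′ F ⟩
      (QΣ.Σ a (λ l → weight l 0) Q.⊞ weight a 0) Q.⊞ QΣ.Σ r′ (λ c → QΣ.Σ a (λ l → weight l (suc c)))
        ≈⟨ solve 3 (λ x y z → (x :+ y) :+ z := (x :+ z) :+ y) QR.refl
             (QΣ.Σ a (λ l → weight l 0)) (weight a 0) (QΣ.Σ r′ (λ c → QΣ.Σ a (λ l → weight l (suc c)))) ⟩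
      (QΣ.Σ a (λ l → weight l 0) Q.⊞ QΣ.Σ r′ (λ c → QΣ.Σ a (λ l → weight l (suc c)))) Q.⊞ weight a 0
        ≈⟨ Q.⊞-congʳ (weight a 0) (QR.trans (QR.sym (QΣ.Σ-unfoldˡ r′ (λ c → QΣ.Σ a (λ l → weight l c))))
                                            (QΣ.Σ-≡ _ (≡.sym r≡))) ⟩
      QΣ.Σ r (λ c → QΣ.Σ a (λ l → weight l c)) Q.⊞ weight a 0
        ≈⟨ QR.+-cong (QR.trans (QΣ.Σ-comm r a _) (QR.sym (QR.trans (QΣ.Σ-blocks r a _)
             (QΣ.Σ-cong a (λ l → QΣ.Σ-cong r (λ c → q^-≡ (ℕ.*-identityˡ _))))))) (q^-≡ (≡.trans (ℕ.+-identityʳ _) (≡.sym (ℕ.*-identityˡ _)))) ⟩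
      qInt 1 (r * a) Q.⊞ q^ (1 * (r * a))
        ≡⟨ ≡.cong (qInt 1) (ℕ.+-comm 1 (r * a)) ⟩
      qInt 1 (r * a + 1) ∎
      where open import Algebra.Solver.Ring.NaturalCoefficients.Default Q.PS-commutativeSemiring

  lhs-coefficient : ∀ a → (A r n ⊛ invP r n) a Q.≋ pow n (qInt 1 (r * a + 1))
  lhs-coefficient a = begin
    (A r n ⊛ invP r n) a
      ≈⟨ QR.trans (⊛≋⊠ (A r n) (invP r n) a) (T.⊠-cong (A≋descGF r n) (invP≋geomInvs r n) a) ⟩
    (descGF r n letters (0 , 0) 0 T.⊠ geomInvs r 0 n) a
      ≈⟨ descGF-coefficient (suc a) n letters length-letters letters-Unique letters<N (0 , 0) Valid-zero 0 a ℕ.≤-refl ⟩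
    q^ (r * 0 * a) Q.⊠ barredProduct (suc a) letters (0 , 0) a
      ≈⟨ q^-unit _ (≡.cong (_* a) (ℕ.*-zeroʳ r)) ⟩
    barredProduct (suc a) letters (0 , 0) a
      ≈⟨ QΣ.ΠL-cong letters (λ v v∈ → below-origin a v (All.lookup letters<N v∈)) ⟩
    QΣ.ΠL (λ _ → qInt 1 (r * a + 1)) letters
      ≈⟨ ΠL-const (qInt 1 (r * a + 1)) letters ⟩
    pow (length letters) (qInt 1 (r * a + 1))
      ≡⟨ ≡.cong (λ k → pow k (qInt 1 (r * a + 1))) length-letters ⟩
    pow n (qInt 1 (r * a + 1)) ∎

proposition4p1 : (r n : ℕ) → 1 ≤ r → (a b : ℕ) →
    (A r n ⊛ invP r n) a b ≡ sumS (suc n) (rhsTerm r n) a b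
proposition4p1 r n 1≤r a b =
  ≡.trans (LeftHandSide.lhs-coefficient r n 1≤r a b) (≡.sym (RightHandSide.rhs-coefficient r n a b))
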